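{- Let $r,q$ be positive integers with $q\ge r+1$, and let $G$ be a $2q$-path degenerate graph. Define $f(0)=1$ and, for integers $x\ge1$, \[ f(x)=\begin{cases}x+2+\log_2\frac{q-1}{q-x}, & \text{if } q<2r,\\ x+2, & \text{otherwise}.\end{cases} \] Then $G$ has a good linear order with respect to $f$ up to $r$.
   Context: A strict ear of $G$ is a path with distinct endpoints whose internal vertices have degree $2$ in $G$; a $p$-reduction deletes an isolated vertex, a vertex of degree $1$, or the internal vertices of a strict ear of length at least $p$; $G$ is $p$-path degenerate if it reduces to the empty graph by $p$-reductions. For a linear order $\pi$ of $V(G)$ and integer $x\ge0$, $u$ is weakly $x$-reachable from $v$ if $u\le_\pi v$ and there is a $u$–$v$ path of length at most $x$ all of whose internal vertices $w$ satisfy $u<_\pi w$; $\mathrm{WReach}_x[G,\pi,v]$ is the set of such $u$. A linear order $\pi$ of $V(G)$ is a good linear order with respect to $f$ up to $r$ if $\max_{v\in V(G)}|\mathrm{WReach}_x[G,\pi,v]|\le f(x)$ for every integer $0\le x\le r$. -}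

module Defs where

open import Data.Nat using (ℕ; zero; suc; _<?_; _+_; _*_; _∸_; _^_; _≤_; _<_)
open import Data.Bool using (Bool; true; false; _∧_; not; if_then_else_)
open import Data.Fin using (Fin; toℕ; _≟_)
open import Data.Fin.Permutation using (Permutation′; _⟨$⟩ʳ_)
open import Data.List using (List; []; _∷_; _++_; length; map; allFin)
open import Data.Nat.ListAction using (sum)
open import Data.Bool.ListAction using (any)
open import Data.List.Relation.Unary.All using (All)
open import Data.List.Relation.Unary.Linked using (Linked)
open import Data.List.Relation.Unary.Unique.Propositional using (Unique)
open import Data.Product using (Σ; _×_)
open import Data.Sum using (_⊎_)
open import Relation.Binary.PropositionalEquality using (_≡_)
open import Relation.Nullary.Decidable using (⌊_⌋)

record Graph (n : ℕ) : Set where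
  field
    adj   : Fin n → Fin n → Bool
    sym   : ∀ u v → adj u v ≡ adj v u
    irref : ∀ v → adj v v ≡ false
open Graph public

module _ {n : ℕ} (G : Graph n) where

  -- A path (as its vertex sequence): distinct vertices, consecutive ones adjacent.
  -- Its length is (number of vertices) - 1.
  IsPath : List (Fin n) → Set
  IsPath L = Unique L × Linked (λ a b → adj G a b ≡ true) L

  -- Vertex subsets; the graphs arising during reductions are the induced subgraphs G[S].
  VSet : Set
  VSet = Fin n → Bool

  deg : VSet → Fin n → ℕ
  deg S v = sum (map (λ w → if S w ∧ adj G v w then 1 else 0) (allFin n))

  removeL : VSet → List (Fin n) → VSet
  removeL S D w = S w ∧ not (any (λ u → ⌊ u ≟ w ⌋) D)

  data Reduction (p : ℕ) (S S' : VSet) : Set where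
    delVertex : (v : Fin n) → S v ≡ true → (deg S v ≡ 0 ⊎ deg S v ≡ 1) →
                (∀ w → S' w ≡ removeL S (v ∷ []) w) → Reduction p S S'
    delEar : (a b : Fin n) (I : List (Fin n)) →
             IsPath (a ∷ I ++ b ∷ []) →
             All (λ w → S w ≡ true) (a ∷ I ++ b ∷ []) →
             All (λ w → deg S w ≡ 2) I →
             p ≤ suc (length I) →
             (∀ w → S' w ≡ removeL S I w) → Reduction p S S'

  data Reduces (p : ℕ) (S : VSet) : Set where
    done : (∀ w → S w ≡ false) → Reduces p S
    step : (S' : VSet) → Reduction p S S' → Reduces p S' → Reduces p S

  PathDegenerate : ℕ → Set
  PathDegenerate p = Reduces p (λ _ → true)

  -- A linear order of V(G) is given by a permutation: u ≤π v iff rank u ≤ rank v.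
  module _ (π : Permutation′ n) where
    rank : Fin n → ℕ
    rank v = toℕ (π ⟨$⟩ʳ v)

    WReach : ℕ → Fin n → Fin n → Set
    WReach x v u =
      rank u ≤ rank v ×
      (u ≡ v ⊎
       Σ (List (Fin n)) λ I →
         IsPath (u ∷ I ++ v ∷ []) × suc (length I) ≤ x × All (λ w → rank u < rank w) I)

    -- π is good w.r.t. f up to r, where B x m means "m ≤ f(x)".
    -- |A| ≤ f(x) is stated as: every duplicate-free list of elements of A has length ≤ f(x).
    GoodOrder : (ℕ → ℕ → Set) → ℕ → Set
    GoodOrder B r = ∀ x → x ≤ r → ∀ v → (L : List (Fin n)) → Unique L →
                    All (WReach x v) L → B x (length L)

-- FBound q r x m  ⟺  m ≤ f(x)  (for natural m and 0 ≤ x ≤ r < q), where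
-- f(0) = 1; for x ≥ 1, f(x) = x + 2 + log₂((q-1)/(q-x)) if q < 2r, else x + 2.
-- Since m is an integer and 1 ≤ (q-1)/(q-x) for 1 ≤ x < q:
--   m ≤ x + 2 + log₂((q-1)/(q-x))  ⟺  (q-x) · 2^(m ∸ (x+2)) ≤ q-1.
FBound : ℕ → ℕ → ℕ → ℕ → Set
FBound q r zero m = m ≤ 1
FBound q r (suc y) m =
  if ⌊ q <? 2 * r ⌋
  then (q ∸ suc y) * 2 ^ (m ∸ (suc y + 2)) ≤ q ∸ 1
  else m ≤ suc y + 2

module Submission where

open import Defs renaming (sym to adj-sym)
open import Data.Nat using (ℕ; zero; suc; _+_; _*_; _∸_; _^_; _≤_; _<_; z≤n; s≤s; s≤s⁻¹; _<?_; _≤?_; ∣_-_∣)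
open import Data.Nat.Properties hiding (_≟_)
open import Data.Nat.ListAction using (sum)
open import Data.Bool using (Bool; true; false; _∧_; not; if_then_else_)
import Data.Bool.Properties as Boolₚ
open import Data.Bool.ListAction using (any)
open import Data.Empty using (⊥; ⊥-elim)
open import Data.Fin using (Fin; _≟_; toℕ; fromℕ<)
open import Data.Fin.Properties using (toℕ<n; toℕ-injective; toℕ-fromℕ<)
open import Data.Fin.Permutation using (Permutation′; permutation; _⟨$⟩ʳ_)
open import Data.List using (List; []; _∷_; _++_; [_]; length; map; reverse; replicate; filter; take; drop; allFin; initLast; _∷ʳ′_)
open import Data.List.Properties
  using (∷-injectiveʳ; length-++; length-replicate; length-take; unfold-reverse; length-reverse; ++-assoc; length-tabulate)
open import Data.List.Membership.Propositional using (_∈_; _∉_)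
open import Data.List.Membership.Propositional.Properties using (∈-∃++; ∈-++⁻; ∈-++⁺ˡ; ∈-++⁺ʳ; ∈-allFin)
open import Data.List.Relation.Binary.Permutation.Propositional using (_↭_; prep; ↭-sym; ↭-trans; ↭⇒↭ₛ)
open import Data.List.Relation.Binary.Permutation.Propositional.Properties using (shift; ++⁺ˡ; ↭-reverse; ∈-resp-↭)
open import Data.List.Relation.Unary.All using (All; []; _∷_)
import Data.List.Relation.Unary.All as All
import Data.List.Relation.Unary.All.Properties as Allₚ
import Data.List.Relation.Unary.AllPairs as AllPairs
open import Data.List.Relation.Unary.AllPairs using (AllPairs; []; _∷_)
open import Data.List.Relation.Unary.Any using (here; there)
open import Data.List.Relation.Unary.Linked using (Linked; [-]; _∷_)
open import Data.List.Relation.Unary.Unique.Propositional using (Unique)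
import Data.List.Relation.Unary.Unique.Propositional.Properties as Uniqueₚ
open import Data.Product using (Σ; ∃; _×_; _,_; proj₁; proj₂)
import Data.Product as Product
open import Data.Sum using (_⊎_; inj₁; inj₂)
import Data.Sum as Sum
open import Function using (_∘_)
open import Relation.Binary.Definitions using (tri<; tri≈; tri>)
open import Relation.Binary.PropositionalEquality hiding ([_])
open import Relation.Nullary using (¬_; yes; no; Dec; contradiction)
open import Relation.Nullary.Decidable using (⌊_⌋)
open import Relation.Unary using (Decidable)
open import Relation.Unary.Properties using (∁?)
open import Algebra.Properties.CommutativeSemigroup +-commutativeSemigroup using (x∙yz≈y∙xz)


-- Order V(G) backwards along a 2q-reduction sequence: the vertices deleted by a step are placed after
-- all vertices that survive it.  By induction along the sequence, every vertex v of the current graph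
-- satisfies |WReach_x[v]| ≤ f(x) for every ranking that extends this order and puts the current graph
-- below the deleted vertices.  A deleted vertex v of degree ≤ 1 reaches the rest only through its
-- unique neighbour w, so WReach_x[v] ⊆ {v} ∪ WReach_{x−1}[w].  The interior I₁ … I_k of a deleted ear
-- a I₁ … I_k b (k ≥ 2q − 1) is ordered I_q, I₁, …, I_{q−1}, I_k, …, I_{q+1}.  As x ≤ r < q, a vertex I_i
-- with i < q weakly reaches only I_{i−x}, …, I_i, possibly the centre I_q, and, through a at distance i,
-- WReach_{x−i}[a]; so it reaches at most i + t + f(x − i) ≤ f(x) vertices, where t = 1 only if
-- q ≤ i + x, which is exactly when the logarithmic term of f gains 1.  The right half is symmetric with
-- b, and no path of length < 2q between surviving vertices can enter an ear, so the induction goes on.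


module _ {A : Set} where

  private variable
    x y : A
    xs ys : List A
    i j : ℕ

  infix 4 _[_]=_

  data _[_]=_ : List A → ℕ → A → Set where
    here  : (x ∷ xs) [ 0 ]= x
    there : xs [ i ]= y → (x ∷ xs) [ suc i ]= y

  []=-functional : xs [ i ]= x → xs [ i ]= y → x ≡ y
  []=-functional here      here      = refl
  []=-functional (there p) (there q) = []=-functional p q

  []=⇒∈ : xs [ i ]= x → x ∈ xs
  []=⇒∈ here      = here refl
  []=⇒∈ (there p) = there ([]=⇒∈ p)

  ∈⇒[]= : x ∈ xs → ∃ λ i → xs [ i ]= x
  ∈⇒[]= (here refl) = 0 , here
  ∈⇒[]= (there m)   = Product.map suc there (∈⇒[]= m)

  []=-injective : Unique xs → xs [ i ]= x → xs [ j ]= x → i ≡ j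
  []=-injective _          here      here      = refl
  []=-injective (x∉ ∷ _)   here      (there q) = contradiction refl (All.lookup x∉ ([]=⇒∈ q))
  []=-injective (x∉ ∷ _)   (there p) here      = contradiction refl (All.lookup x∉ ([]=⇒∈ p))
  []=-injective (_ ∷ uxs)  (there p) (there q) = cong suc ([]=-injective uxs p q)

  []=⇒<length : xs [ i ]= x → i < length xs
  []=⇒<length here      = s≤s z≤n
  []=⇒<length (there p) = s≤s ([]=⇒<length p)

  <length⇒[]= : ∀ (xs : List A) {i} → i < length xs → ∃ λ x → xs [ i ]= x
  <length⇒[]= (x ∷ xs) {zero}  _         = x , here
  <length⇒[]= (x ∷ xs) {suc i} (s≤s i<) = Product.map₂ there (<length⇒[]= xs i<)

  []=-++ˡ : xs [ i ]= x → (xs ++ ys) [ i ]= x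
  []=-++ˡ here      = here
  []=-++ˡ (there p) = there ([]=-++ˡ p)

  []=-++ʳ : ∀ xs → ys [ i ]= x → (xs ++ ys) [ length xs + i ]= x
  []=-++ʳ []       p = p
  []=-++ʳ (_ ∷ xs) p = there ([]=-++ʳ xs p)

  []=-++⁻ : ∀ xs → (xs ++ ys) [ i ]= x → xs [ i ]= x ⊎ ∃ λ j → i ≡ length xs + j × ys [ j ]= x
  []=-++⁻ []       p         = inj₂ (_ , refl , p)
  []=-++⁻ (_ ∷ xs) here      = inj₁ here
  []=-++⁻ (_ ∷ xs) (there p) with []=-++⁻ xs p
  ... | inj₁ q            = inj₁ (there q)
  ... | inj₂ (j , eq , q) = inj₂ (j , cong suc eq , q)

  []=-reverse : ∀ xs → xs [ i ]= x → reverse xs [ length xs ∸ suc i ]= x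
  []=-reverse (y ∷ ys) here rewrite unfold-reverse y ys =
    subst (λ j → (reverse ys ++ [ y ]) [ j ]= y) (trans (+-identityʳ _) (length-reverse ys)) ([]=-++ʳ (reverse ys) here)
  []=-reverse (y ∷ ys) (there p) rewrite unfold-reverse y ys = []=-++ˡ ([]=-reverse ys p)

  []=-split : xs [ i ]= x → ∃ λ ys → ∃ λ zs → xs ≡ ys ++ x ∷ zs × length ys ≡ i
  []=-split {xs = _ ∷ xs} here = [] , xs , refl , refl
  []=-split {xs = y ∷ _} (there p) with []=-split p
  ... | ys , zs , refl , refl = y ∷ ys , zs , refl , refl

  Linked-[]= : ∀ {R : A → A → Set} → Linked R xs → xs [ i ]= x → xs [ suc i ]= y → R x y
  Linked-[]= (Rxy ∷ _) here      (there here) = Rxy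
  Linked-[]= (_ ∷ l)   (there p) (there q)    = Linked-[]= l p q
  Linked-[]= [-]       here      (there ())

  Linked-++⁻ : ∀ {R : A → A → Set} xs {s} → Linked R (xs ++ s ∷ ys) → Linked R (xs ++ [ s ]) × Linked R (s ∷ ys)
  Linked-++⁻ []           l         = [-] , l
  Linked-++⁻ (x ∷ [])     (r ∷ l)   = (r ∷ [-]) , l
  Linked-++⁻ (x ∷ y ∷ xs) (r ∷ l)   = Product.map₁ (r ∷_) (Linked-++⁻ (y ∷ xs) l)

  AllPairs-++⁻ : ∀ {R : A → A → Set} xs → AllPairs R (xs ++ ys) →
                 AllPairs R xs × AllPairs R ys × All (λ x → All (R x) ys) xs
  AllPairs-++⁻ []       p          = [] , p , []
  AllPairs-++⁻ (x ∷ xs) (Rx ∷ p) with AllPairs-++⁻ xs p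
  ... | pxs , pys , cross = Allₚ.++⁻ˡ xs Rx ∷ pxs , pys , Allₚ.++⁻ʳ xs Rx ∷ cross

  Unique-++-disjoint : ∀ xs → Unique (xs ++ ys) → x ∈ xs → y ∈ ys → x ≢ y
  Unique-++-disjoint xs u x∈ y∈ = All.lookup (All.lookup (proj₂ (proj₂ (AllPairs-++⁻ xs u))) x∈) y∈

  Unique-snoc : ∀ xs {s} → Unique (xs ++ s ∷ ys) → Unique (xs ++ [ s ])
  Unique-snoc []       _          = [] ∷ []
  Unique-snoc (x ∷ xs) (x∉ ∷ u) = Allₚ.++⁺ (Allₚ.++⁻ˡ xs x∉) (All.head (Allₚ.++⁻ʳ xs x∉) ∷ []) ∷ Unique-snoc xs u

  count : (A → Bool) → List A → ℕ
  count g K = sum (map (λ w → if g w then 1 else 0) K)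

  length≤count : (g : A → Bool) (K L : List A) → Unique L → All (_∈ K) L → All (λ w → g w ≡ true) L →
                 length L ≤ count g K
  length≤count g K [] _ _ _ = z≤n
  length≤count g K (x ∷ L) (x∉ ∷ u) (x∈ ∷ L⊆) (gx ∷ gL) with ∈-∃++ x∈
  ... | K₁ , K₂ , refl = begin
    suc (length L)                ≤⟨ s≤s (length≤count g (K₁ ++ K₂) L u (All.zipWith avoid (x∉ , L⊆)) gL) ⟩
    suc (count g (K₁ ++ K₂))      ≡⟨ sym (count-++-∷ K₁) ⟩
    count g (K₁ ++ x ∷ K₂)        ∎
    where
    open ≤-Reasoning
    avoid : ∀ {w} → x ≢ w × w ∈ K₁ ++ x ∷ K₂ → w ∈ K₁ ++ K₂
    avoid (x≢w , w∈) with ∈-++⁻ K₁ w∈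
    ... | inj₁ w∈K₁         = ∈-++⁺ˡ w∈K₁
    ... | inj₂ (here refl)  = contradiction refl x≢w
    ... | inj₂ (there w∈K₂) = ∈-++⁺ʳ K₁ w∈K₂
    count-++-∷ : ∀ K₁ → count g (K₁ ++ x ∷ K₂) ≡ suc (count g (K₁ ++ K₂))
    count-++-∷ []       rewrite gx = refl
    count-++-∷ (w ∷ K₁) = trans (cong ((if g w then 1 else 0) +_) (count-++-∷ K₁)) (+-suc _ _)

  count-true : ∀ (K : List A) → count (λ _ → true) K ≡ length K
  count-true []      = refl
  count-true (_ ∷ K) = cong suc (count-true K)

  length≤length : (K L : List A) → Unique L → All (_∈ K) L → length L ≤ length K
  length≤length K L u L⊆K =
    subst (length L ≤_) (count-true K) (length≤count (λ _ → true) K L u L⊆K (All.universal (λ _ → refl) L))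

  length≤1 : ∀ {v : A} (L : List A) → Unique L → All (_≡ v) L → length L ≤ 1
  length≤1 []          _                  _                 = z≤n
  length≤1 (_ ∷ [])    _                  _                 = s≤s z≤n
  length≤1 (_ ∷ _ ∷ _) ((x≢y ∷ _) ∷ _) (refl ∷ refl ∷ _) = contradiction refl x≢y

  length-filter-∁ : ∀ {P : A → Set} (P? : Decidable P) xs → length xs ≡ length (filter P? xs) + length (filter (∁? P?) xs)
  length-filter-∁ P? []       = refl
  length-filter-∁ P? (x ∷ xs) with P? x
  ... | yes _ = cong suc (length-filter-∁ P? xs)
  ... | no  _ = trans (cong suc (length-filter-∁ P? xs)) (sym (+-suc _ _))

  []=-drop : ∀ lo {xs : List A} {i x} → xs [ lo + i ]= x → drop lo xs [ i ]= x
  []=-drop zero    p         = p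
  []=-drop (suc lo) (there p) = []=-drop lo p

  []=-take : ∀ {m} {xs : List A} {i x} → xs [ i ]= x → i < m → take m xs [ i ]= x
  []=-take {m = suc m} here      _         = here
  []=-take {m = suc m} (there p) (s≤s i<m) = there ([]=-take p i<m)

  window : List A → ℕ → ℕ → List A
  window xs lo hi = take (suc hi ∸ lo) (drop lo xs)

  []=⇒∈-window : ∀ {xs : List A} {lo hi j x} → xs [ j ]= x → lo ≤ j → j ≤ hi → x ∈ window xs lo hi
  []=⇒∈-window {lo = lo} {j = j} p lo≤j j≤hi =
    []=⇒∈ ([]=-take ([]=-drop lo (subst (λ i → _ [ i ]= _) (sym (m+[n∸m]≡n lo≤j)) p)) (∸-monoˡ-< (s≤s j≤hi) lo≤j))

  length≤window : ∀ (xs : List A) lo hi c t (L : List A) → Unique L →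
                  All (λ u → (∃ λ j → lo ≤ j × j ≤ hi × xs [ j ]= u) ⊎ (u ≡ c × t ≡ 1)) L →
                  length L ≤ (suc hi ∸ lo) + t
  length≤window xs lo hi c t L u L⊆ = begin
    length L                                          ≤⟨ length≤length K L u (All.map member L⊆) ⟩
    length K                                          ≡⟨ length-++ (window xs lo hi) ⟩
    length (window xs lo hi) + length (replicate t c) ≤⟨ +-mono-≤ length-window (≤-reflexive (length-replicate t)) ⟩
    (suc hi ∸ lo) + t                                 ∎
    where
    open ≤-Reasoning
    K : List A
    K = window xs lo hi ++ replicate t c
    length-window : length (window xs lo hi) ≤ suc hi ∸ lo
    length-window = ≤-trans (≤-reflexive (length-take (suc hi ∸ lo) (drop lo xs))) (m⊓n≤m _ _)
    member : ∀ {u} → (∃ λ j → lo ≤ j × j ≤ hi × xs [ j ]= u) ⊎ (u ≡ c × t ≡ 1) → u ∈ K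
    member (inj₁ (_ , lo≤j , j≤hi , p)) = ∈-++⁺ˡ ([]=⇒∈-window p lo≤j j≤hi)
    member (inj₂ (refl , refl))         = ∈-++⁺ʳ (window xs lo hi) (here refl)

  length-≤-∷ʳ : ∀ ys {w : A} {B t post} → ys ++ [ w ] ≡ B ++ t ∷ post → length B ≤ length ys
  length-≤-∷ʳ _        {B = []}        _  = z≤n
  length-≤-∷ʳ []       {B = _ ∷ []}    ()
  length-≤-∷ʳ []       {B = _ ∷ _ ∷ _} ()
  length-≤-∷ʳ (_ ∷ ys) {B = _ ∷ _}     eq = s≤s (length-≤-∷ʳ ys (∷-injectiveʳ eq))

  split-first : ∀ {P Q : A → Set} → (∀ y → P y ⊎ Q y) → ∀ ys →
                All P ys ⊎ ∃ λ B → ∃ λ t → ∃ λ post → ys ≡ B ++ t ∷ post × All P B × Q t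
  split-first P⊎Q [] = inj₁ []
  split-first P⊎Q (y ∷ ys) with P⊎Q y
  ... | inj₂ Qy = inj₂ ([] , y , ys , refl , [] , Qy)
  ... | inj₁ Py with split-first P⊎Q ys
  ...   | inj₁ Pys                         = inj₁ (Py ∷ Pys)
  ...   | inj₂ (B , t , post , refl , PB , Qt) = inj₂ (y ∷ B , t , post , refl , Py ∷ PB , Qt)

  split-last : ∀ {P Q : A → Set} → (∀ y → P y ⊎ Q y) → ∀ ys →
               All P ys ⊎ ∃ λ pre → ∃ λ t → ∃ λ B → ys ≡ pre ++ t ∷ B × Q t × All P B
  split-last P⊎Q [] = inj₁ []
  split-last P⊎Q (y ∷ ys) with split-last P⊎Q ys
  ... | inj₂ (pre , t , B , refl , Qt , PB) = inj₂ (y ∷ pre , t , B , refl , Qt , PB)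
  ... | inj₁ Pys with P⊎Q y
  ...   | inj₁ Py = inj₁ (Py ∷ Pys)
  ...   | inj₂ Qy = inj₂ ([] , y , ys , refl , Qy , Pys)


∣n-suc-n∣≡1 : ∀ n → ∣ n - suc n ∣ ≡ 1
∣n-suc-n∣≡1 zero    = refl
∣n-suc-n∣≡1 (suc n) = ∣n-suc-n∣≡1 n

∣suc-n-n∣≡1 : ∀ n → ∣ suc n - n ∣ ≡ 1
∣suc-n-n∣≡1 zero    = refl
∣suc-n-n∣≡1 (suc n) = ∣suc-n-n∣≡1 n

∣m-n∣≤o⇒n≤m+o : ∀ {m n o} → ∣ m - n ∣ ≤ o → n ≤ m + o
∣m-n∣≤o⇒n≤m+o {m} {n} d = ≤-trans (m≤n+∣m-n∣ n m) (+-monoʳ-≤ m (≤-trans (≤-reflexive (∣-∣-comm n m)) d))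

∣m-n∣≤o⇒m≤n+o : ∀ {m n o} → ∣ m - n ∣ ≤ o → m ≤ n + o
∣m-n∣≤o⇒m≤n+o {m} {n} d = ≤-trans (m≤n+∣m-n∣ m n) (+-monoʳ-≤ n d)

indicator : ∀ {P : Set} → Dec P → ℕ
indicator (yes _) = 1
indicator (no  _) = 0

indicator≤1 : ∀ {P : Set} (d : Dec P) → indicator d ≤ 1
indicator≤1 (yes _) = ≤-refl
indicator≤1 (no  _) = z≤n

indicator-yes : ∀ {P : Set} (d : Dec P) → P → indicator d ≡ 1
indicator-yes (yes _) _ = refl
indicator-yes (no ¬p) p = contradiction p ¬p

indicator≡1 : ∀ {P : Set} (d : Dec P) → indicator d ≡ 1 → P
indicator≡1 (yes p) _ = p


-- Arithmetic of f

module FBoundProperties (q r : ℕ) where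

  LogBound : ℕ → ℕ → Set
  LogBound x m = (q ∸ x) * 2 ^ (m ∸ (x + 2)) ≤ q ∸ 1

  FBound-intro : ∀ {x m} → 1 ≤ x → (q < 2 * r → LogBound x m) → (¬ q < 2 * r → m ≤ x + 2) → FBound q r x m
  FBound-intro {suc y} _ log lin with q <? 2 * r
  ... | yes q<2r = log q<2r
  ... | no  q≮2r = lin q≮2r

  FBound-elim : ∀ {x m} → 1 ≤ x → FBound q r x m → (q < 2 * r → LogBound x m) × (¬ q < 2 * r → m ≤ x + 2)
  FBound-elim {suc y} _ h with q <? 2 * r
  ... | yes q<2r = (λ _ → h) , (λ q≮2r → contradiction q<2r q≮2r)
  ... | no  q≮2r = (λ q<2r → contradiction q<2r q≮2r) , (λ _ → h)

  FBound-downClosed : ∀ x {m m′} → m ≤ m′ → FBound q r x m′ → FBound q r x m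
  FBound-downClosed zero    m≤m′ h = ≤-trans m≤m′ h
  FBound-downClosed (suc y) {m} m≤m′ h with FBound-elim (s≤s z≤n) h
  ... | log , lin = FBound-intro (s≤s z≤n)
    (λ q<2r → ≤-trans (*-monoʳ-≤ (q ∸ suc y) (^-monoʳ-≤ 2 (∸-monoˡ-≤ (suc y + 2) m≤m′))) (log q<2r))
    (λ q≮2r → ≤-trans m≤m′ (lin q≮2r))

  FBound-linear : ∀ {x m} → 1 ≤ x → m ≤ x + 2 → FBound q r x m
  FBound-linear {x} {m} 1≤x m≤x+2 = FBound-intro 1≤x log (λ _ → m≤x+2)
    where
    log : q < 2 * r → LogBound x m
    log _ rewrite m≤n⇒m∸n≡0 m≤x+2 | *-identityʳ (q ∸ x) = ∸-monoʳ-≤ q 1≤x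

  FBound-zero : ∀ x → FBound q r x 0
  FBound-zero zero    = z≤n
  FBound-zero (suc y) = FBound-linear (s≤s z≤n) z≤n

  private
    exponent-shift : ∀ d z t m → (d + t + m) ∸ (d + z + 2) ≤ t + (m ∸ (z + 2))
    exponent-shift d z t m = begin
      (d + t + m) ∸ (d + z + 2)     ≡⟨ cong₂ _∸_ (+-assoc d t m) (+-assoc d z 2) ⟩
      (d + (t + m)) ∸ (d + (z + 2)) ≡⟨ [m+n]∸[m+o]≡n∸o d (t + m) (z + 2) ⟩
      (t + m) ∸ (z + 2)             ≤⟨ m≤n+o⇒m∸n≤o (t + m) (z + 2) t+m≤ ⟩
      t + (m ∸ (z + 2))             ∎
      where
      open ≤-Reasoning
      t+m≤ : t + m ≤ (z + 2) + (t + (m ∸ (z + 2)))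
      t+m≤ = ≤-trans (+-monoʳ-≤ t (m≤n+m∸n m (z + 2))) (≤-reflexive (x∙yz≈y∙xz t (z + 2) (m ∸ (z + 2))))

    LogBound-shift : ∀ d z t m → (q ∸ (d + z)) * 2 ^ t ≤ q ∸ z → LogBound z m → LogBound (d + z) (d + t + m)
    LogBound-shift d z t m doubling log = begin
      (q ∸ (d + z)) * 2 ^ ((d + t + m) ∸ (d + z + 2)) ≤⟨ *-monoʳ-≤ (q ∸ (d + z)) (^-monoʳ-≤ 2 (exponent-shift d z t m)) ⟩
      (q ∸ (d + z)) * 2 ^ (t + E)                     ≡⟨ cong ((q ∸ (d + z)) *_) (^-distribˡ-+-* 2 t E) ⟩
      (q ∸ (d + z)) * (2 ^ t * 2 ^ E)                 ≡⟨ sym (*-assoc (q ∸ (d + z)) (2 ^ t) (2 ^ E)) ⟩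
      (q ∸ (d + z)) * 2 ^ t * 2 ^ E                   ≤⟨ *-monoˡ-≤ (2 ^ E) doubling ⟩
      (q ∸ z) * 2 ^ E                                 ≤⟨ log ⟩
      q ∸ 1                                           ∎
      where
      open ≤-Reasoning
      E : ℕ
      E = m ∸ (z + 2)

    -- With x = d + z and p = q ∸ x, the hypothesis says p ≤ d, while q ∸ z = d + p.
    doubling : ∀ d z → d + z ≤ q → q ≤ d + (d + z) → (q ∸ (d + z)) * 2 ^ 1 ≤ q ∸ z
    doubling d z x≤q q≤d+x with m≤n⇒∃[o]m+o≡n x≤q
    ... | p , refl = begin
      (d + z + p ∸ (d + z)) * 2 ^ 1 ≡⟨ cong (λ w → w * 2 ^ 1) (m+n∸m≡n (d + z) p) ⟩
      p * 2 ^ 1                     ≡⟨ *-comm p 2 ⟩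
      p + (p + 0)                   ≡⟨ cong (p +_) (+-identityʳ p) ⟩
      p + p                         ≤⟨ +-monoˡ-≤ p p≤d ⟩
      d + p                         ≡⟨ sym (m+n∸m≡n z (d + p)) ⟩
      z + (d + p) ∸ z               ≡⟨ cong (_∸ z) (x∙yz≈y∙xz z d p) ⟩
      d + (z + p) ∸ z               ≡⟨ cong (_∸ z) (sym (+-assoc d z p)) ⟩
      d + z + p ∸ z                 ∎
      where
      open ≤-Reasoning
      p≤d : p ≤ d
      p≤d = +-cancelˡ-≤ (d + z) p d (≤-trans q≤d+x (≤-reflexive (+-comm d (d + z))))

  FBound-shift₀ : ∀ {d z m} → 1 ≤ d → FBound q r z m → FBound q r (d + z) (d + 0 + m)
  FBound-shift₀ {d} {zero} {m} 1≤d m≤1 =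
    FBound-linear (≤-trans 1≤d (m≤m+n d 0)) (+-monoʳ-≤ (d + 0) (≤-trans m≤1 (n≤1+n 1)))
  FBound-shift₀ {d} {suc z} {m} 1≤d h with FBound-elim (s≤s z≤n) h
  ... | log , lin = FBound-intro (≤-trans (s≤s z≤n) (m≤n+m (suc z) d))
    (λ q<2r → LogBound-shift d (suc z) 0 m (≤-trans (≤-reflexive (*-identityʳ _)) (∸-monoʳ-≤ q (m≤n+m (suc z) d))) (log q<2r))
    (λ q≮2r → ≤-trans (+-monoʳ-≤ (d + 0) (lin q≮2r))
                (≤-reflexive (trans (cong (_+ (suc z + 2)) (+-identityʳ d)) (sym (+-assoc d (suc z) 2)))))

  FBound-shift₁ : ∀ {d z m} → 1 ≤ d → d + z ≤ r → r < q → q ≤ d + (d + z) →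
                  FBound q r z m → FBound q r (d + z) (d + 1 + m)
  FBound-shift₁ {d} {zero} {m} 1≤d _ _ _ m≤1 =
    FBound-linear (≤-trans 1≤d (m≤m+n d 0))
      (≤-trans (≤-reflexive (+-assoc d 1 m)) (+-mono-≤ (m≤m+n d 0) (s≤s m≤1)))
  FBound-shift₁ {d} {suc z} {m} 1≤d x≤r r<q q≤d+x h with FBound-elim (s≤s z≤n) h
  ... | log , _ = FBound-intro (≤-trans (s≤s z≤n) (m≤n+m (suc z) d))
    (λ q<2r → LogBound-shift d (suc z) 1 m (doubling d (suc z) (≤-trans x≤r (<⇒≤ r<q)) q≤d+x) (log q<2r))
    (λ q≮2r → contradiction (≤-trans (s≤s q≤d+x) d+x<2r) q≮2r)
    where
    x = d + suc z
    d+x<2r : suc (d + x) ≤ 2 * r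
    d+x<2r = ≤-trans (+-monoˡ-< x (m<m+n d (s≤s z≤n))) (+-mono-≤ x≤r (≤-trans x≤r (≤-reflexive (sym (+-identityʳ r)))))

  -- In terms of f: f(d + z) ≥ f(z) + d + t.  The case t = 1 needs q ≤ 2d + z, which makes the factor
  -- (q − 1)/(q − d − z) in f(d + z) at least twice the factor (q − 1)/(q − z) in f(z).
  FBound-shift : ∀ {d z t m} → 1 ≤ d → d + z ≤ r → r < q → t ≤ 1 → (t ≡ 1 → q ≤ d + (d + z)) →
                 FBound q r z m → FBound q r (d + z) (d + t + m)
  FBound-shift {t = zero}  1≤d _   _   _ _    = FBound-shift₀ 1≤d
  FBound-shift {t = suc zero} 1≤d x≤r r<q _ q≤d+x = FBound-shift₁ 1≤d x≤r r<q (q≤d+x refl)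
  FBound-shift {t = suc (suc _)} _ _ _ (s≤s ()) _


module GraphProperties {n : ℕ} (G : Graph n) where

  open import Data.List.Membership.DecPropositional (_≟_ {n}) using (_∈?_)

  V : Set
  V = Fin n

  Adj : V → V → Set
  Adj u v = adj G u v ≡ true

  Adj-sym : ∀ {u v} → Adj u v → Adj v u
  Adj-sym {u} {v} e = trans (adj-sym G v u) e

  Adj-irrefl : ∀ {v} → ¬ Adj v v
  Adj-irrefl {v} e with trans (sym e) (irref G v)
  ... | ()

  module Removal (S S′ : VSet G) (D : List V) (S′≗ : ∀ w → S′ w ≡ removeL G S D w) where

    private
      ∧-not-elim : ∀ {a b} → a ∧ not b ≡ true → a ≡ true × b ≡ false
      ∧-not-elim {true} {false} _ = refl , refl

      any-≟ : ∀ {w : V} (D : List V) → w ∈ D → any (λ u → ⌊ u ≟ w ⌋) D ≡ true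
      any-≟ {w} (u ∷ D) w∈ with u ≟ w | w∈
      ... | yes _    | _          = refl
      ... | no  u≢w  | here u≡w   = contradiction (sym u≡w) u≢w
      ... | no  _    | there w∈′  = any-≟ D w∈′

      any-≢ : ∀ {w : V} (D : List V) → w ∉ D → any (λ u → ⌊ u ≟ w ⌋) D ≡ false
      any-≢ []      _   = refl
      any-≢ {w} (u ∷ D) w∉ with u ≟ w
      ... | yes refl = contradiction (here refl) w∉
      ... | no  _    = any-≢ D (λ w∈ → w∉ (there w∈))

    kept⁻ : ∀ {w} → S′ w ≡ true → S w ≡ true × w ∉ D
    kept⁻ {w} S′w with ∧-not-elim (trans (sym (S′≗ w)) S′w)
    ... | Sw , none = Sw , λ w∈ → contradiction (trans (sym (any-≟ D w∈)) none) λ ()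

    kept⁺ : ∀ {w} → S w ≡ true → w ∉ D → S′ w ≡ true
    kept⁺ {w} Sw w∉ = trans (S′≗ w) (cong₂ (λ a b → a ∧ not b) Sw (any-≢ D w∉))

    removed : ∀ {w} → S w ≡ true → S′ w ≡ false → w ∈ D
    removed {w} Sw S′w with w ∈? D
    ... | yes w∈ = w∈
    ... | no  w∉ = contradiction (trans (sym (kept⁺ Sw w∉)) S′w) λ ()

  length≤deg : ∀ S v L → Unique L → All (λ w → S w ∧ adj G v w ≡ true) L → length L ≤ deg G S v
  length≤deg S v L u = length≤count (λ w → S w ∧ adj G v w) (allFin n) L u (All.universal ∈-allFin L)

  private
    ∧-intro : ∀ {a b : Bool} → a ≡ true → b ≡ true → a ∧ b ≡ true
    ∧-intro refl refl = refl

  2≤deg : ∀ {S v p s} → p ≢ s → Adj p v → Adj v s → S p ≡ true → S s ≡ true → 2 ≤ deg G S v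
  2≤deg {S} {v} p≢s pv vs Sp Ss =
    length≤deg S v (_ ∷ _ ∷ []) ((p≢s ∷ []) ∷ [] ∷ []) (∧-intro Sp (Adj-sym pv) ∷ ∧-intro Ss vs ∷ [])

  3≤deg : ∀ {S v a b c} → a ≢ b → a ≢ c → b ≢ c → S a ≡ true → S b ≡ true → S c ≡ true →
          Adj v a → Adj v b → Adj v c → 3 ≤ deg G S v
  3≤deg {S} {v} a≢b a≢c b≢c Sa Sb Sc va vb vc =
    length≤deg S v (_ ∷ _ ∷ _ ∷ []) ((a≢b ∷ a≢c ∷ []) ∷ (b≢c ∷ []) ∷ [] ∷ [])
      (∧-intro Sa va ∷ ∧-intro Sb vb ∷ ∧-intro Sc vc ∷ [])

  deg≤1⇒neighbour-unique : ∀ {S v w w′} → deg G S v ≤ 1 → S w ≡ true → Adj w v → S w′ ≡ true → Adj w′ v → w ≡ w′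
  deg≤1⇒neighbour-unique {w = w} {w′} deg≤1 Sw wv Sw′ w′v with w ≟ w′
  ... | yes w≡w′ = w≡w′
  ... | no  w≢w′ = contradiction (2≤deg w≢w′ wv (Adj-sym w′v) Sw Sw′) (<⇒≱ (s≤s deg≤1))

  IsPath-split : ∀ xs {s ys} → IsPath G (xs ++ s ∷ ys) → IsPath G (xs ++ [ s ]) × IsPath G (s ∷ ys)
  IsPath-split xs (u , l) with Linked-++⁻ xs l
  ... | l₁ , l₂ = (Unique-snoc xs u , l₁) , (proj₁ (proj₂ (AllPairs-++⁻ xs u)) , l₂)

  Linked-last : ∀ {R : V → V → Set} x xs {z} → Linked R ((x ∷ xs) ++ [ z ]) → ∃ λ p → p ∈ x ∷ xs × R p z
  Linked-last x []       (Rxz ∷ _) = x , here refl , Rxz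
  Linked-last x (y ∷ xs) (_ ∷ l)   with Linked-last y xs l
  ... | p , p∈ , Rpz = p , there p∈ , Rpz

  middle⇒2≤deg : ∀ {S z} x xs y ys → IsPath G ((x ∷ xs) ++ z ∷ y ∷ ys) →
                 All (λ t → S t ≡ true) ((x ∷ xs) ++ z ∷ y ∷ ys) → 2 ≤ deg G S z
  middle⇒2≤deg {z = z} x xs y ys path inS with IsPath-split (x ∷ xs) path
  ... | before , (_ , zy ∷ _) with Linked-last x xs (proj₂ before)
  ...   | p , p∈ , pz = 2≤deg (Unique-++-disjoint (x ∷ xs) (proj₁ path) p∈ y∈) pz zy
                          (All.lookup inS (∈-++⁺ˡ p∈)) (All.lookup inS (∈-++⁺ʳ (x ∷ xs) y∈))
    where
    y∈ : y ∈ z ∷ y ∷ ys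
    y∈ = there (here refl)

  internal⇒2≤deg : ∀ {S u J w z} → IsPath G (u ∷ J ++ [ w ]) → All (λ t → S t ≡ true) (u ∷ J ++ [ w ]) → z ∈ J →
                   2 ≤ deg G S z
  internal⇒2≤deg {u = u} {w = w} {z} path inS z∈J with ∈-∃++ z∈J
  ... | J₁ , [] , refl rewrite ++-assoc J₁ [ z ] [ w ] = middle⇒2≤deg u J₁ w [] path inS
  ... | J₁ , s ∷ J₂ , refl rewrite ++-assoc J₁ (z ∷ s ∷ J₂) [ w ] = middle⇒2≤deg u J₁ s (J₂ ++ [ w ]) path inS


-- The induction along a reduction sequence

module Invariant {n : ℕ} (G : Graph n) (q r : ℕ) (r<q : r < q) where

  open GraphProperties G public
  open FBoundProperties q r public

  WReach′ : (V → ℕ) → ℕ → V → V → Set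
  WReach′ R x v u =
    R u ≤ R v × (u ≡ v ⊎ Σ (List V) λ I → IsPath G (u ∷ I ++ v ∷ []) × suc (length I) ≤ x × All (λ w → R u < R w) I)

  Bounded : (V → ℕ) → ℕ → V → Set
  Bounded R x v = ∀ L → Unique L → All (WReach′ R x v) L → FBound q r x (length L)

  Increasing : (V → ℕ) → List V → Set
  Increasing R o = ∀ {i j a b} → o [ i ]= a → o [ j ]= b → i < j → R a < R b

  InitialSegment : (V → ℕ) → VSet G → Set
  InitialSegment R S = ∀ {u w} → S u ≡ true → S w ≡ false → R u < R w

  ShortPathClosed : VSet G → Set
  ShortPathClosed S = ∀ {u J w} → S u ≡ true → S w ≡ true → IsPath G (u ∷ J ++ w ∷ []) → suc (length J) < 2 * q →
                      All (λ z → S z ≡ true) J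

  -- The final ranking restricts, at every stage S of the reduction, to a ranking as in bounded.
  record EliminationOrder (S : VSet G) : Set where
    field
      order    : List V
      unique   : Unique order
      sound    : ∀ {v} → v ∈ order → S v ≡ true
      complete : ∀ {v} → S v ≡ true → v ∈ order
      bounded  : ∀ R → Increasing R order → InitialSegment R S → ShortPathClosed S →
                 ∀ x → x ≤ r → ∀ {v} → S v ≡ true → Bounded R x v

  ≤r⇒<2q : ∀ {x} → x ≤ r → x < 2 * q
  ≤r⇒<2q x≤r = ≤-trans (s≤s x≤r) (≤-trans r<q (m≤m+n q (q + 0)))

  WReach′-mono : ∀ {R x x′ v u} → x ≤ x′ → WReach′ R x v u → WReach′ R x′ v u
  WReach′-mono _    (Ru≤Rv , inj₁ u≡v)                   = Ru≤Rv , inj₁ u≡v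
  WReach′-mono x≤x′ (Ru≤Rv , inj₂ (I , path , len , up)) = Ru≤Rv , inj₂ (I , path , ≤-trans len x≤x′ , up)

  WReach′-initial : ∀ {R S x v u} → InitialSegment R S → S v ≡ true → WReach′ R x v u → S u ≡ true
  WReach′-initial {S = S} {u = u} initial Sv (Ru≤Rv , _) with S u in Su
  ... | true  = refl
  ... | false = contradiction Ru≤Rv (<⇒≱ (initial Sv Su))

  bounded-zero : ∀ {R v} → Bounded R 0 v
  bounded-zero L u reach = length≤1 L u (All.map trivial reach)
    where
    trivial : ∀ {R v u} → WReach′ R 0 v u → u ≡ v
    trivial (_ , inj₁ u≡v)             = u≡v
    trivial (_ , inj₂ (_ , _ , () , _))

  module Split (S′ : VSet G) {P : V → Set} (L : List V) (uL : Unique L) (pL : All P L) where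

    private
      kept? : Decidable (λ u → S′ u ≡ true)
      kept? u = S′ u Boolₚ.≟ true

    Kept Gone : List V
    Kept = filter kept? L
    Gone = filter (∁? kept?) L

    length-split : length L ≡ length Kept + length Gone
    length-split = length-filter-∁ kept? L

    unique-kept : Unique Kept
    unique-kept = Uniqueₚ.filter⁺ kept? uL

    unique-gone : Unique Gone
    unique-gone = Uniqueₚ.filter⁺ (∁? kept?) uL

    all-kept : All (λ u → P u × S′ u ≡ true) Kept
    all-kept = All.zip (Allₚ.filter⁺ kept? pL , Allₚ.all-filter kept? L)

    all-gone : All (λ u → P u × S′ u ≡ false) Gone
    all-gone = All.zipWith (λ (pu , S′u≢true) → pu , Boolₚ.¬-not S′u≢true)
                 (Allₚ.filter⁺ (∁? kept?) pL , Allₚ.all-filter (∁? kept?) L)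

  Increasing-++ˡ : ∀ {R} xs {ys} → Increasing R (xs ++ ys) → Increasing R xs
  Increasing-++ˡ xs inc a b i<j = inc ([]=-++ˡ a) ([]=-++ˡ b) i<j

  Increasing-++ʳ : ∀ {R} xs {ys} → Increasing R (xs ++ ys) → Increasing R ys
  Increasing-++ʳ xs inc a b i<j = inc ([]=-++ʳ xs a) ([]=-++ʳ xs b) (+-monoʳ-< (length xs) i<j)

  Increasing-++-cross : ∀ {R} xs {ys a b} → Increasing R (xs ++ ys) → a ∈ xs → b ∈ ys → R a < R b
  Increasing-++-cross xs inc a∈ b∈ with ∈⇒[]= a∈ | ∈⇒[]= b∈
  ... | i , a↦ | j , b↦ = inc ([]=-++ˡ a↦) ([]=-++ʳ xs b↦) (≤-trans ([]=⇒<length a↦) (m≤m+n (length xs) j))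

  NewBounded : (S S′ : VSet G) → List V → Set
  NewBounded S S′ N = ∀ R → Increasing R N → InitialSegment R S → InitialSegment R S′ → ShortPathClosed S →
                      (∀ x → x ≤ r → ∀ {w} → S′ w ≡ true → Bounded R x w) →
                      ∀ x → x ≤ r → ∀ {v} → v ∈ N → Bounded R x v

  extend : ∀ {S S′} (N : List V) → EliminationOrder S′ →
           (∀ {w} → S′ w ≡ true → S w ≡ true) →
           (∀ {w} → w ∈ N → S w ≡ true × S′ w ≡ false) →
           (∀ {w} → S w ≡ true → S′ w ≡ false → w ∈ N) →
           Unique N → (ShortPathClosed S → ShortPathClosed S′) → NewBounded S S′ N → EliminationOrder S
  extend {S} {S′} N E′ S′⊆S N-removed removed-N uniqueN closed′ boundedN = record
    { order    = order ++ N
    ; unique   = Uniqueₚ.++⁺ unique uniqueN disjoint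
    ; sound    = sound′
    ; complete = complete′
    ; bounded  = bounded′
    }
    where
    open EliminationOrder E′
    disjoint : ∀ {w} → w ∈ order × w ∈ N → ⊥
    disjoint (w∈o , w∈N) with trans (sym (sound w∈o)) (proj₂ (N-removed w∈N))
    ... | ()
    sound′ : ∀ {v} → v ∈ order ++ N → S v ≡ true
    sound′ {v} v∈ with ∈-++⁻ order v∈
    ... | inj₁ v∈o = S′⊆S (sound v∈o)
    ... | inj₂ v∈N = proj₁ (N-removed v∈N)
    complete′ : ∀ {v} → S v ≡ true → v ∈ order ++ N
    complete′ {v} Sv with S′ v in S′v
    ... | true  = ∈-++⁺ˡ (complete S′v)
    ... | false = ∈-++⁺ʳ order (removed-N Sv S′v)
    initial′ : ∀ {R} → Increasing R (order ++ N) → InitialSegment R S → InitialSegment R S′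
    initial′ inc initial {u} {w} S′u S′w with S w in Sw
    ... | false = initial (S′⊆S S′u) Sw
    ... | true  = Increasing-++-cross order inc (complete S′u) (removed-N Sw S′w)
    IH : ∀ {R} → Increasing R (order ++ N) → InitialSegment R S → ShortPathClosed S →
         ∀ x → x ≤ r → ∀ {w} → S′ w ≡ true → Bounded R x w
    IH {R} inc initial closed = bounded R (Increasing-++ˡ order inc) (initial′ inc initial) (closed′ closed)
    bounded′ : ∀ R → Increasing R (order ++ N) → InitialSegment R S → ShortPathClosed S →
               ∀ x → x ≤ r → ∀ {v} → S v ≡ true → Bounded R x v
    bounded′ R inc initial closed x x≤r {v} Sv with S′ v in S′v
    ... | true  = IH inc initial closed x x≤r S′v
    ... | false = boundedN R (Increasing-++ʳ order inc) initial (initial′ inc initial) closed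
                    (IH inc initial closed) x x≤r (removed-N Sv S′v)

  -- Deleting a vertex of degree at most one

  WReach′-penultimate : ∀ {R S y v u} → ShortPathClosed S → InitialSegment R S → S v ≡ true → suc y ≤ r →
                WReach′ R (suc y) v u → u ≢ v → ∃ λ w → S w ≡ true × Adj w v × WReach′ R y w u
  WReach′-penultimate _ _ _ _ (_ , inj₁ u≡v) u≢v = contradiction u≡v u≢v
  WReach′-penultimate {R} {S} {y} {v} {u} closed initial Sv sy≤r reach@(_ , inj₂ (I , path , len , up)) _
    with Su ← WReach′-initial initial Sv reach | closed Su Sv path (≤r⇒<2q (≤-trans len sy≤r)) | initLast I
  ... | _ | [] = u , Su , uv , ≤-refl , inj₁ refl
    where uv = Linked-[]= (proj₂ path) here (there here)
  ... | inI | I′ ∷ʳ′ w with IsPath-split (u ∷ I′) (subst (IsPath G) (cong (u ∷_) (++-assoc I′ [ w ] [ v ])) path)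
  ...   | path′ , (_ , wv ∷ _) =
          w , All.lookup inI w∈ , wv , <⇒≤ (All.lookup up w∈) , inj₂ (I′ , path′ , len′ , Allₚ.++⁻ˡ I′ up)
    where
    w∈ : w ∈ I′ ++ [ w ]
    w∈ = ∈-++⁺ʳ I′ (here refl)
    len′ : suc (length I′) ≤ y
    len′ = s≤s⁻¹ (≤-trans (≤-reflexive (cong suc (sym (trans (length-++ I′) (+-comm (length I′) 1))))) len)

  deleteVertex : ∀ {S S′ v} → S v ≡ true → deg G S v ≤ 1 → (∀ w → S′ w ≡ removeL G S [ v ] w) →
                 EliminationOrder S′ → EliminationOrder S
  deleteVertex {S} {S′} {v} Sv deg≤1 S′≗ E′ =
    extend [ v ] E′ (proj₁ ∘ kept⁻) (λ { (here refl) → Sv , S′v }) removed ([] ∷ []) closed′ bounded-v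
    where
    open Removal S S′ [ v ] S′≗
    S′v : S′ v ≡ false
    S′v = Boolₚ.¬-not λ S′v → proj₂ (kept⁻ S′v) (here refl)
    closed′ : ShortPathClosed S → ShortPathClosed S′
    closed′ closed {u} {J} {w} S′u S′w path len = All.tabulate λ z∈J →
      kept⁺ (All.lookup inJ z∈J) λ { (here refl) → contradiction (internal⇒2≤deg path inPath z∈J) (<⇒≱ (s≤s deg≤1)) }
      where
      inJ : All (λ z → S z ≡ true) J
      inJ = closed (proj₁ (kept⁻ S′u)) (proj₁ (kept⁻ S′w)) path len
      inPath : All (λ z → S z ≡ true) (u ∷ J ++ [ w ])
      inPath = proj₁ (kept⁻ S′u) ∷ Allₚ.++⁺ inJ (proj₁ (kept⁻ S′w) ∷ [])
    bounded-v : NewBounded S S′ [ v ]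
    bounded-v R _ _ _ _ _  zero    _    (here refl) = bounded-zero
    bounded-v R _ initial _ closed IH (suc y) sy≤r (here refl) L uL reach =
      FBound-downClosed (suc y) (≤-trans (≤-reflexive length-split) (≤-trans (+-monoʳ-≤ (length Kept) gone≤1)
                                                                        (≤-reflexive (+-comm (length Kept) 1))))
                        (FBound-shift₀ {d = 1} {z = y} (s≤s z≤n) kept-bound)
      where
      open Split S′ L uL reach
      gone≤1 : length Gone ≤ 1
      gone≤1 = length≤1 Gone unique-gone (All.map (λ (ru , S′u) → only v (removed (WReach′-initial initial Sv ru) S′u)) all-gone)
        where
        only : ∀ {u} v → u ∈ [ v ] → u ≡ v
        only v (here u≡v) = u≡v
      predecessor : ∀ {u} → WReach′ R (suc y) v u × S′ u ≡ true → ∃ λ w → S w ≡ true × Adj w v × WReach′ R y w u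
      predecessor (ru , S′u) = WReach′-penultimate closed initial Sv sy≤r ru λ { refl → proj₂ (kept⁻ S′u) (here refl) }
      kept-bound : FBound q r y (length Kept)
      kept-bound with Kept | unique-kept | all-kept
      ... | []      | _  | _                 = FBound-zero y
      ... | u₀ ∷ K  | uK | ru₀ ∷ rK with predecessor ru₀
      ...   | w₀ , Sw₀ , w₀v , _ =
              IH y (≤-trans (n≤1+n y) sy≤r) (kept⁺ Sw₀ λ { (here refl) → Adj-irrefl w₀v })
                 (u₀ ∷ K) uK (All.map via-w₀ (ru₀ ∷ rK))
        where
        via-w₀ : ∀ {u} → WReach′ R (suc y) v u × S′ u ≡ true → WReach′ R y w₀ u
        via-w₀ p with predecessor p
        ... | w , Sw , wv , rw with deg≤1⇒neighbour-unique deg≤1 Sw wv Sw₀ w₀v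
        ...   | refl = rw


  -- Deleting the interior of a long strict ear

  module Ear {S S′ : VSet G} {a b : V} {I : List V}
             (path : IsPath G (a ∷ I ++ b ∷ [])) (inS : All (λ w → S w ≡ true) (a ∷ I ++ b ∷ []))
             (deg2 : All (λ w → deg G S w ≡ 2) I) (long : 2 * q ≤ suc (length I))
             (S′≗ : ∀ w → S′ w ≡ removeL G S I w) where

    open Removal S S′ I S′≗
    open import Data.List.Membership.DecPropositional (_≟_ {n}) using (_∈?_)
    open import Data.List.Relation.Binary.Permutation.Setoid.Properties (setoid V) using (Unique-resp-↭)

    E : List V
    E = a ∷ I ++ b ∷ []

    k : ℕ
    k = length I

    E-unique : Unique E
    E-unique = proj₁ path

    length-E : length E ≡ suc (suc k)
    length-E = cong suc (trans (length-++ I) (+-comm k 1))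

    E-b : E [ suc k ]= b
    E-b = there (subst (λ j → (I ++ [ b ]) [ j ]= b) (+-identityʳ k) ([]=-++ʳ I here))

    E-S : ∀ {j w} → E [ j ]= w → S w ≡ true
    E-S w↦ = All.lookup inS ([]=⇒∈ w↦)

    I-S : ∀ {w} → w ∈ I → S w ≡ true
    I-S w∈ = All.lookup inS (there (∈-++⁺ˡ w∈))

    internal⇒position : ∀ {w} → w ∈ I → ∃ λ j → j < k × E [ suc j ]= w
    internal⇒position w∈ with ∈⇒[]= w∈
    ... | j , w↦ = j , []=⇒<length w↦ , there ([]=-++ˡ w↦)

    position⇒internal : ∀ {j w} → E [ suc j ]= w → j < k → w ∈ I
    position⇒internal (there w↦) j<k with []=-++⁻ I w↦
    ... | inj₁ w↦I            = []=⇒∈ w↦I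
    ... | inj₂ (i , refl , _) = contradiction (m≤m+n k i) (<⇒≱ j<k)

    internal-position : ∀ {w j} → w ∈ I → E [ j ]= w → ∃ λ j₀ → j ≡ suc j₀ × j₀ < k
    internal-position w∈ w↦ with internal⇒position w∈
    ... | j₀ , j₀<k , w↦′ = j₀ , []=-injective E-unique w↦ w↦′ , j₀<k

    external-position : ∀ {j w} → E [ j ]= w → w ∉ I → (j ≡ 0 × w ≡ a) ⊎ (j ≡ suc k × w ≡ b)
    external-position here _ = inj₁ (refl , refl)
    external-position {suc j} w↦ w∉ with j <? k
    ... | yes j<k = contradiction (position⇒internal w↦ j<k) w∉
    ... | no  j≮k = inj₂ (cong suc j≡k , []=-functional (subst (λ i → E [ suc i ]= _) j≡k w↦) E-b)
      where
      j≡k : j ≡ k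
      j≡k = ≤-antisym (s≤s⁻¹ (s≤s⁻¹ (subst (suc j <_) length-E ([]=⇒<length w↦)))) (≮⇒≥ j≮k)

    ear-neighbour : ∀ {j w w′} → E [ suc j ]= w → j < k → S w′ ≡ true → Adj w w′ →
                    E [ j ]= w′ ⊎ E [ suc (suc j) ]= w′
    ear-neighbour {j} {w} {w′} w↦ j<k Sw′ ww′
      with <length⇒[]= E (subst (j <_) (sym length-E) (≤-trans j<k (≤-trans (n≤1+n k) (n≤1+n (suc k)))))
         | <length⇒[]= E (subst (suc (suc j) <_) (sym length-E) (s≤s (s≤s j<k)))
    ... | p , p↦ | s , s↦ with w′ ≟ p | w′ ≟ s
    ...   | yes refl | _        = inj₁ p↦
    ...   | no  _    | yes refl = inj₂ s↦
    ...   | no  w′≢p | no  w′≢s =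
            contradiction (subst (3 ≤_) (All.lookup deg2 (position⇒internal w↦ j<k))
                             (3≤deg p≢s (w′≢p ∘ sym) (w′≢s ∘ sym) (E-S p↦) (E-S s↦) Sw′
                                (Adj-sym (Linked-[]= (proj₂ path) p↦ w↦)) (Linked-[]= (proj₂ path) w↦ s↦) ww′))
                          (<⇒≱ (n<1+n 2))
      where
      p≢s : p ≢ s
      p≢s refl with []=-injective E-unique p↦ s↦
      ... | ()

    ear-step : ∀ {j w w′} → w ∈ I → E [ j ]= w → S w′ ≡ true → Adj w w′ →
               ∃ λ j′ → E [ j′ ]= w′ × ∣ j - j′ ∣ ≤ 1
    ear-step w∈ w↦ Sw′ ww′ with internal-position w∈ w↦
    ... | j₀ , refl , j₀<k with ear-neighbour w↦ j₀<k Sw′ ww′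
    ...   | inj₁ w′↦ = j₀ , w′↦ , ≤-reflexive (∣suc-n-n∣≡1 j₀)
    ...   | inj₂ w′↦ = suc (suc j₀) , w′↦ , ≤-reflexive (∣n-suc-n∣≡1 (suc j₀))

    ear-walk : ∀ J {w v j} → Linked Adj (w ∷ J ++ [ v ]) → All (_∈ I) (w ∷ J) → S v ≡ true → E [ j ]= w →
               ∃ λ j′ → E [ j′ ]= v × ∣ j - j′ ∣ ≤ suc (length J)
    ear-walk []      (wv ∷ _) (w∈ ∷ _) Sv w↦ = ear-step w∈ w↦ Sv wv
    ear-walk (z ∷ J) {j = j} (wz ∷ l) (w∈ ∷ z∈ ∷ J⊆) Sv w↦ with ear-step w∈ w↦ (I-S z∈) wz
    ... | jz , z↦ , d₁ with ear-walk J l (z∈ ∷ J⊆) Sv z↦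
    ...   | j′ , v↦ , d₂ = j′ , v↦ , ≤-trans (∣-∣-triangle j jz j′) (+-mono-≤ d₁ d₂)

    -- A walk inside the ear changes the position by at most one per step, so it cannot jump over c.
    ear-crossing : ∀ J {w v j i} c → Linked Adj (w ∷ J ++ [ v ]) → All (_∈ I) (w ∷ J) → S v ≡ true →
                   E [ j ]= w → E [ i ]= v → j < c → c < i → ∃ λ z → z ∈ J × E [ c ]= z
    ear-crossing [] {j = j} {i} c (wv ∷ _) (w∈ ∷ _) Sv w↦ v↦ j<c c<i with ear-step w∈ w↦ Sv wv
    ... | j′ , v↦′ , d rewrite []=-injective E-unique v↦′ v↦ =
          contradiction (≤-trans (s≤s j<c) c<i) (<⇒≱ (s≤s (≤-trans (∣m-n∣≤o⇒n≤m+o d) (≤-reflexive (+-comm j 1)))))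
    ear-crossing (z ∷ J) {j = j} c (wz ∷ l) (w∈ ∷ z∈ ∷ J⊆) Sv w↦ v↦ j<c c<i with ear-step w∈ w↦ (I-S z∈) wz
    ... | jz , z↦ , d with <-cmp jz c
    ...   | tri≈ _ refl _ = z , here refl , z↦
    ...   | tri< jz<c _ _ = Product.map₂ (Product.map₁ there) (ear-crossing J c l (z∈ ∷ J⊆) Sv z↦ v↦ jz<c c<i)
    ...   | tri> _ _ c<jz = contradiction (≤-trans (s≤s j<c) c<jz)
                                (<⇒≱ (s≤s (≤-trans (∣m-n∣≤o⇒n≤m+o d) (≤-reflexive (+-comm j 1)))))

    ear-entry : ∀ {s z jz} → s ∉ I → S s ≡ true → Adj s z → z ∈ I → E [ jz ]= z → (s ≡ a × jz ≡ 1) ⊎ (s ≡ b × jz ≡ k)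
    ear-entry s∉ Ss sz z∈ z↦ with ear-step z∈ z↦ Ss (Adj-sym sz) | internal-position z∈ z↦
    ... | js , s↦ , d | j₀ , refl , j₀<k with external-position s↦ s∉
    ...   | inj₁ (refl , refl) = inj₁ (refl , cong suc (n≤0⇒n≡0 (s≤s⁻¹ d)))
    ...   | inj₂ (refl , refl) = inj₂ (refl , ≤-antisym j₀<k (≤-trans (∣m-n∣≤o⇒n≤m+o {j₀} d) (≤-reflexive (+-comm j₀ 1))))

    ear-segment : ∀ B {s v i} → Linked Adj (s ∷ B ++ [ v ]) → s ∉ I → S s ≡ true → All (_∈ I) B → v ∈ I → E [ i ]= v →
                  (s ≡ a × i ≤ suc (length B)) ⊎ (s ≡ b × suc k ≤ i + suc (length B))
    ear-segment [] (sv ∷ _) s∉ Ss _ v∈ v↦ with ear-entry s∉ Ss sv v∈ v↦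
    ... | inj₁ (refl , refl) = inj₁ (refl , ≤-refl)
    ... | inj₂ (refl , refl) = inj₂ (refl , ≤-reflexive (+-comm 1 k))
    ear-segment (z ∷ B) {i = i} (sz ∷ l) s∉ Ss (z∈ ∷ B⊆) v∈ v↦ with internal⇒position z∈
    ... | j₀ , _ , z↦ with ear-walk B l (z∈ ∷ B⊆) (I-S v∈) z↦
    ...   | i′ , v↦′ , d rewrite []=-injective E-unique v↦′ v↦ with ear-entry s∉ Ss sz z∈ z↦
    ...     | inj₁ (refl , refl) = inj₁ (refl , ∣m-n∣≤o⇒n≤m+o {1} d)
    ...     | inj₂ (refl , jz≡k) = inj₂ (refl , ≤-trans (s≤s (subst (_≤ i + suc (length B)) jz≡k (∣m-n∣≤o⇒m≤n+o {suc j₀} d)))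
                                                    (≤-reflexive (sym (+-suc i (suc (length B))))))

    ear-traversal : ∀ B {s z t} → Linked Adj (s ∷ z ∷ B ++ [ t ]) → s ∉ I → t ∉ I → S s ≡ true → S t ≡ true → s ≢ t →
                    All (_∈ I) (z ∷ B) → k ≤ suc (length B)
    ear-traversal B (sz ∷ l) s∉ t∉ Ss St s≢t (z∈ ∷ B⊆) with internal⇒position z∈
    ... | j₀ , _ , z↦ with ear-walk B l (z∈ ∷ B⊆) St z↦ | ear-entry s∉ Ss sz z∈ z↦
    ...   | jt , t↦ , d | entry with external-position t↦ t∉ | entry
    ...     | inj₁ (_ , refl)    | inj₁ (refl , _)    = contradiction refl s≢t
    ...     | inj₂ (_ , refl)    | inj₂ (refl , _)    = contradiction refl s≢t
    ...     | inj₂ (refl , refl) | inj₁ (refl , refl) = d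
    ...     | inj₁ (refl , refl) | inj₂ (refl , jz≡k) = subst (_≤ suc (length B)) jz≡k d

    ∈-or-∉ : ∀ z → z ∈ I ⊎ z ∉ I
    ∈-or-∉ z with z ∈? I
    ... | yes z∈ = inj₁ z∈
    ... | no  z∉ = inj₂ z∉

    ∉-or-∈ : ∀ z → z ∉ I ⊎ z ∈ I
    ∉-or-∈ z = Sum.swap (∈-or-∉ z)

    -- A path between remaining vertices that enters the ear must traverse all of it.
    short-path-avoids-ear : ShortPathClosed S → ∀ {u J w} → S′ u ≡ true → S′ w ≡ true →
                            IsPath G (u ∷ J ++ [ w ]) → suc (length J) < 2 * q → All (_∉ I) J
    short-path-avoids-ear closed {u} {J} {w} S′u S′w path′ len with split-first ∉-or-∈ J
    ... | inj₁ J∉ = J∉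
    ... | inj₂ (A , z , rest , refl , A∉ , z∈) with split-first ∈-or-∉ (rest ++ [ w ])
    ...   | inj₁ all∈ = contradiction (All.lookup all∈ (∈-++⁺ʳ rest (here refl))) (proj₂ (kept⁻ S′w))
    ...   | inj₂ (B , t , post , eq , B∈ , t∉) = contradiction (≤-trans long (s≤s k≤J)) (<⇒≱ len)
      where
      Su : S u ≡ true
      Su = proj₁ (kept⁻ S′u)
      inJ : All (λ y → S y ≡ true) (A ++ z ∷ rest)
      inJ = closed Su (proj₁ (kept⁻ S′w)) path′ len
      reassoc : u ∷ (A ++ z ∷ rest) ++ [ w ] ≡ (u ∷ A) ++ z ∷ (B ++ t ∷ post)
      reassoc = cong (u ∷_) (trans (++-assoc A (z ∷ rest) [ w ]) (cong (λ ys → A ++ z ∷ ys) eq))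
      path″ : IsPath G ((u ∷ A) ++ z ∷ (B ++ t ∷ post))
      path″ = subst (IsPath G) reassoc path′
      parts : IsPath G ((u ∷ A) ++ [ z ]) × IsPath G (z ∷ B ++ t ∷ post)
      parts = IsPath-split (u ∷ A) path″
      s-adj : ∃ λ s → s ∈ u ∷ A × Adj s z
      s-adj = Linked-last u A (proj₂ (proj₁ parts))
      s : V
      s = proj₁ s-adj
      s∈ : s ∈ u ∷ A
      s∈ = proj₁ (proj₂ s-adj)
      t∈ : t ∈ z ∷ B ++ t ∷ post
      t∈ = there (∈-++⁺ʳ B (here refl))
      on-path : ∀ {y} → y ∈ (u ∷ A) ++ z ∷ (B ++ t ∷ post) → S y ≡ true
      on-path = All.lookup (subst (All (λ y → S y ≡ true)) reassoc (Su ∷ Allₚ.++⁺ inJ (proj₁ (kept⁻ S′w) ∷ [])))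
      s∉ : s ∉ I
      s∉ with s∈
      ... | here s≡u  = subst (_∉ I) (sym s≡u) (proj₂ (kept⁻ S′u))
      ... | there s∈A = All.lookup A∉ s∈A
      k≤B : k ≤ suc (length B)
      k≤B = ear-traversal B (proj₂ (proj₂ s-adj) ∷ proj₁ (Linked-++⁻ (z ∷ B) (proj₂ (proj₂ parts)))) s∉ t∉
              (on-path (∈-++⁺ˡ s∈)) (on-path (∈-++⁺ʳ (u ∷ A) t∈))
              (Unique-++-disjoint (u ∷ A) (proj₁ path″) s∈ t∈) (z∈ ∷ B∈)
      k≤J : k ≤ length (A ++ z ∷ rest)
      k≤J = ≤-trans k≤B (≤-trans (s≤s (length-≤-∷ʳ rest eq))
                          (≤-trans (m≤n+m (suc (length rest)) (length A)) (≤-reflexive (sym (length-++ A)))))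

    closed′ : ShortPathClosed S → ShortPathClosed S′
    closed′ closed S′u S′w path′ len =
      All.zipWith (λ (Sz , z∉) → kept⁺ Sz z∉)
        (closed (proj₁ (kept⁻ S′u)) (proj₁ (kept⁻ S′w)) path′ len , short-path-avoids-ear closed S′u S′w path′ len)

    1≤q : 1 ≤ q
    1≤q = ≤-trans (s≤s z≤n) r<q

    q≤k : q ≤ k
    q≤k = s≤s⁻¹ (begin
      suc q ≡⟨ +-comm 1 q ⟩
      q + 1 ≤⟨ +-monoʳ-≤ q 1≤q ⟩
      q + q ≡⟨ cong (q +_) (sym (+-identityʳ q)) ⟩
      2 * q ≤⟨ long ⟩
      suc k ∎)
      where open ≤-Reasoning

    suc-pred-q : suc (q ∸ 1) ≡ q
    suc-pred-q = trans (+-comm 1 (q ∸ 1)) (m∸n+n≡m 1≤q)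

    centre-exists : ∃ λ c → I [ q ∸ 1 ]= c
    centre-exists = <length⇒[]= I (subst (_≤ k) (sym suc-pred-q) q≤k)

    centre : V
    centre = proj₁ centre-exists

    E-centre : E [ q ]= centre
    E-centre = subst (λ j → E [ j ]= centre) suc-pred-q (there ([]=-++ˡ (proj₂ centre-exists)))

    private
      I-split : ∃ λ ys → ∃ λ zs → I ≡ ys ++ centre ∷ zs × length ys ≡ q ∸ 1
      I-split = []=-split (proj₂ centre-exists)

    L₁ L₂ : List V
    L₁ = proj₁ I-split
    L₂ = proj₁ (proj₂ I-split)

    I≡ : I ≡ L₁ ++ centre ∷ L₂
    I≡ = proj₁ (proj₂ (proj₂ I-split))

    length-L₁ : length L₁ ≡ q ∸ 1
    length-L₁ = proj₂ (proj₂ (proj₂ I-split))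

    suc-length-L₁ : suc (length L₁) ≡ q
    suc-length-L₁ = trans (cong suc length-L₁) suc-pred-q

    -- The centre comes first, then the positions 1, …, q − 1 in increasing order, then k, k − 1, …, q + 1.
    new : List V
    new = centre ∷ L₁ ++ reverse L₂

    new↭I : new ↭ I
    new↭I = subst (new ↭_) (sym I≡)
      (↭-trans (↭-sym (shift centre L₁ (reverse L₂))) (++⁺ˡ L₁ (prep centre (↭-reverse L₂))))

    unique-new : Unique new
    unique-new = Unique-resp-↭ (↭⇒↭ₛ (↭-sym new↭I)) (proj₁ (AllPairs-++⁻ I (AllPairs.tail E-unique)))

    new-position : ∀ {j w} → E [ suc j ]= w → j < k →
                   (suc j < q × new [ suc j ]= w) ⊎ (suc j ≡ q × w ≡ centre) ⊎ (q < suc j × new [ q + (k ∸ suc j) ]= w)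
    new-position {j} {w} (there w↦) j<k with []=-++⁻ I w↦
    ... | inj₂ (i , refl , _) = contradiction (m≤m+n k i) (<⇒≱ j<k)
    ... | inj₁ w↦I with []=-++⁻ L₁ (subst (λ l → l [ j ]= w) I≡ w↦I)
    ...   | inj₁ w↦L₁ = inj₁ (subst (suc (suc j) ≤_) suc-length-L₁ (s≤s ([]=⇒<length w↦L₁)) , there ([]=-++ˡ w↦L₁))
    ...   | inj₂ (zero , refl , here) = inj₂ (inj₁ (trans (cong suc (+-identityʳ _)) suc-length-L₁ , refl))
    ...   | inj₂ (suc t , refl , there w↦L₂) = inj₂ (inj₂ (centre<j , subst (λ i → new [ i ]= w) position-eq
                                                                    (there ([]=-++ʳ L₁ ([]=-reverse L₂ w↦L₂)))))
      where
      centre<j : q < suc (length L₁ + suc t)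
      centre<j = s≤s (subst (_≤ length L₁ + suc t) suc-length-L₁
                       (≤-trans (≤-reflexive (+-comm 1 (length L₁))) (+-monoʳ-≤ (length L₁) (s≤s z≤n))))
      k≡ : k ≡ length L₁ + suc (length L₂)
      k≡ = trans (cong length I≡) (length-++ L₁)
      position-eq : suc (length L₁ + (length L₂ ∸ suc t)) ≡ q + (k ∸ suc (length L₁ + suc t))
      position-eq = begin
        suc (length L₁ + (length L₂ ∸ suc t))
          ≡⟨ cong (_+ (length L₂ ∸ suc t)) suc-length-L₁ ⟩
        q + (length L₂ ∸ suc t)
          ≡⟨ cong (q +_) (sym ([m+n]∸[m+o]≡n∸o (length L₁) (suc (length L₂)) (suc (suc t)))) ⟩
        q + (length L₁ + suc (length L₂) ∸ (length L₁ + suc (suc t)))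
          ≡⟨ cong₂ (λ x y → q + (x ∸ y)) (sym k≡) (+-suc (length L₁) (suc t)) ⟩
        q + (k ∸ suc (length L₁ + suc t))
          ∎
        where open ≡-Reasoning

    I-S′ : ∀ {w} → w ∈ I → S′ w ≡ false
    I-S′ w∈ = Boolₚ.¬-not λ S′w → proj₂ (kept⁻ S′w) w∈

    module Ranked (R : V → ℕ) (inc : Increasing R new) (initial : InitialSegment R S) (initial′ : InitialSegment R S′)
                  (closed : ShortPathClosed S) where

      rank-position : ∀ {p p′ u v} → new [ p ]= u → new [ p′ ]= v → R u ≤ R v → p ≤ p′
      rank-position {p} {p′} u↦ v↦ Ru≤Rv with p ≤? p′
      ... | yes p≤p′ = p≤p′
      ... | no  p≰p′ = contradiction Ru≤Rv (<⇒≱ (inc v↦ u↦ (≰⇒> p≰p′)))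

      -- Remaining vertices rank below the ear, so a path from u through vertices ranked above u stays in the ear.
      reach-internal : ∀ {u v J x} → u ∈ I → v ∈ I → IsPath G (u ∷ J ++ [ v ]) → suc (length J) ≤ x → x ≤ r →
                       All (λ t → R u < R t) J → All (_∈ I) J
      reach-internal {u} {v} {J} u∈ v∈ path′ len x≤r up =
        All.zipWith in-ear (closed (I-S u∈) (I-S v∈) path′ (≤r⇒<2q (≤-trans len x≤r)) , up)
        where
        in-ear : ∀ {t} → S t ≡ true × R u < R t → t ∈ I
        in-ear {t} (St , Ru<Rt) with S′ t in S′t
        ... | true  = contradiction (initial′ S′t (I-S′ u∈)) (<-asym Ru<Rt)
        ... | false = removed St S′t

      reach-distance : ∀ {u v j i x} → u ∈ I → v ∈ I → E [ j ]= u → E [ i ]= v → x ≤ r → WReach′ R x v u → ∣ j - i ∣ ≤ x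
      reach-distance {j = j} {x = x} _ _ u↦ v↦ _ (_ , inj₁ refl) =
        subst (λ i → ∣ j - i ∣ ≤ x) ([]=-injective E-unique u↦ v↦) (subst (_≤ x) (sym (∣n-n∣≡0 j)) z≤n)
      reach-distance u∈ v∈ u↦ v↦ x≤r (_ , inj₂ (J , path′ , len , up))
        with ear-walk J (proj₂ path′) (u∈ ∷ reach-internal u∈ v∈ path′ len x≤r up) (I-S v∈) u↦
      ... | i′ , v↦′ , d rewrite []=-injective E-unique v↦′ v↦ = ≤-trans d len

      private
        new-left : ∀ {j w} → E [ suc j ]= w → j < k → suc j < q → new [ suc j ]= w
        new-left w↦ j<k j<q with new-position w↦ j<k
        ... | inj₁ (_ , w↦′)          = w↦′
        ... | inj₂ (inj₁ (j≡q , _))   = contradiction j≡q (<⇒≢ j<q)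
        ... | inj₂ (inj₂ (q<j , _))   = contradiction q<j (<-asym j<q)

        new-right : ∀ {j w} → E [ suc j ]= w → j < k → q < suc j → new [ q + (k ∸ suc j) ]= w
        new-right w↦ j<k q<j with new-position w↦ j<k
        ... | inj₁ (j<q , _)          = contradiction q<j (<-asym j<q)
        ... | inj₂ (inj₁ (j≡q , _))   = contradiction (sym j≡q) (<⇒≢ q<j)
        ... | inj₂ (inj₂ (_ , w↦′))   = w↦′

      reach-left : ∀ {x u v i j} → x ≤ r → v ∈ I → E [ i ]= v → i < q → u ∈ I → E [ j ]= u → WReach′ R x v u →
                   (j ≤ i × i ≤ j + x) ⊎ (j ≡ q × q ≤ i + x)
      reach-left {x} x≤r v∈ v↦ i<q u∈ u↦ reach@(Ru≤Rv , _)
        with internal-position v∈ v↦ | internal-position u∈ u↦ | reach-distance u∈ v∈ u↦ v↦ x≤r reach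
      ... | i₀ , refl , i₀<k | j₀ , refl , j₀<k | d with new-position u↦ j₀<k
      ...   | inj₁ (_ , u↦′)        = inj₁ (rank-position u↦′ (new-left v↦ i₀<k i<q) Ru≤Rv , ∣m-n∣≤o⇒n≤m+o d)
      ...   | inj₂ (inj₁ (j≡q , _)) = inj₂ (j≡q , subst (_≤ suc i₀ + x) j≡q (∣m-n∣≤o⇒m≤n+o d))
      ...   | inj₂ (inj₂ (_ , u↦′)) =
              contradiction (≤-trans (m≤m+n q _) (rank-position u↦′ (new-left v↦ i₀<k i<q) Ru≤Rv)) (<⇒≱ i<q)

      reach-centre : ∀ {x u v i j} → v ∈ I → E [ i ]= v → i ≡ q → u ∈ I → E [ j ]= u → WReach′ R x v u → j ≡ q
      reach-centre v∈ v↦ refl u∈ u↦ (Ru≤Rv , _) with internal-position u∈ u↦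
      ... | j₀ , refl , j₀<k with new-position u↦ j₀<k | []=-functional v↦ E-centre
      ...   | inj₁ (_ , u↦′)        | refl = contradiction (rank-position u↦′ here Ru≤Rv) λ ()
      ...   | inj₂ (inj₁ (j≡q , _)) | _    = j≡q
      ...   | inj₂ (inj₂ (_ , u↦′)) | refl =
              contradiction (≤-trans (≤-trans 1≤q (m≤m+n q _)) (rank-position u↦′ here Ru≤Rv)) λ ()

      reach-right : ∀ {x u v i j} → x ≤ r → v ∈ I → E [ i ]= v → q < i → u ∈ I → E [ j ]= u → WReach′ R x v u →
                    (i ≤ j × j ≤ i + x × j ≤ k) ⊎ (j ≡ q × i ≤ q + x)
      reach-right {x} x≤r v∈ v↦ q<i u∈ u↦ reach@(Ru≤Rv , through)
        with internal-position v∈ v↦ | internal-position u∈ u↦ | reach-distance u∈ v∈ u↦ v↦ x≤r reach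
      ... | i₀ , refl , i₀<k | j₀ , refl , j₀<k | d with new-position u↦ j₀<k
      ...   | inj₂ (inj₁ (j≡q , _)) = inj₂ (j≡q , subst (λ j → suc i₀ ≤ j + x) j≡q (∣m-n∣≤o⇒n≤m+o d))
      ...   | inj₂ (inj₂ (_ , u↦′)) = inj₁ (i≤j , ∣m-n∣≤o⇒m≤n+o d , j₀<k)
        where
        i≤j : suc i₀ ≤ suc j₀
        i≤j with suc i₀ ≤? suc j₀
        ... | yes i≤j = i≤j
        ... | no  i≰j = contradiction (+-cancelˡ-≤ q _ _ (rank-position u↦′ (new-right v↦ i₀<k q<i) Ru≤Rv))
                                      (<⇒≱ (∸-monoʳ-< (≰⇒> i≰j) i₀<k))
      -- A path from the left half to the right half passes the centre, which ranks below u.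
      ...   | inj₁ (j<q , u↦′) with through
      ...     | inj₁ refl = contradiction (≤-trans j<q (<⇒≤ q<i)) (<-irrefl ([]=-injective E-unique u↦ v↦))
      ...     | inj₂ (J , path′ , len , up)
                with ear-crossing J q (proj₂ path′) (u∈ ∷ reach-internal u∈ v∈ path′ len x≤r up) (I-S v∈) u↦ v↦ j<q q<i
      ...       | z , z∈J , z↦ with []=-functional z↦ E-centre
      ...         | refl = contradiction (inc here u↦′ (s≤s z≤n)) (<-asym (All.lookup up z∈J))

      -- s is the last vertex outside the ear on the path from u to v, and sl the length of the rest of it.
      exit : ∀ {x u v i} → x ≤ r → v ∈ I → E [ i ]= v → S′ u ≡ true → WReach′ R x v u →
             ∃ λ s → ∃ λ sl → WReach′ R (x ∸ sl) s u × sl ≤ x × ((s ≡ a × i ≤ sl) ⊎ (s ≡ b × suc k ≤ i + sl))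
      exit x≤r v∈ v↦ S′u (_ , inj₁ refl) = contradiction v∈ (proj₂ (kept⁻ S′u))
      exit {x} {u} {v} x≤r v∈ v↦ S′u (_ , inj₂ (J , path′ , len , up)) with split-last ∈-or-∉ (u ∷ J)
      ... | inj₁ (u∈ ∷ _) = contradiction u∈ (proj₂ (kept⁻ S′u))
      ... | inj₂ ([] , s , B , refl , s∉ , B∈) =
            s , suc (length B) , (≤-refl , inj₁ refl) , len , ear-segment B (proj₂ path′) s∉ (proj₁ (kept⁻ S′u)) B∈ v∈ v↦
      ... | inj₂ (_ ∷ A , s , B , refl , s∉ , B∈)
            with IsPath-split (u ∷ A) (subst (IsPath G) (cong (u ∷_) (++-assoc A (s ∷ B) [ v ])) path′)
      ...   | before , after =
              s , suc (length B) , (<⇒≤ Ru<Rs , inj₂ (A , before , m+n≤o⇒m≤o∸n (suc (length A)) len′ , Allₚ.++⁻ˡ A up)) ,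
              ≤-trans (m≤n+m (suc (length B)) (suc (length A))) len′ ,
              ear-segment B (proj₂ after) s∉ Ss B∈ v∈ v↦
        where
        s∈ : s ∈ A ++ s ∷ B
        s∈ = ∈-++⁺ʳ A (here refl)
        Ru<Rs : R u < R s
        Ru<Rs = All.lookup up s∈
        len′ : suc (length A) + suc (length B) ≤ x
        len′ = subst (λ m → suc m ≤ x) (length-++ A) len
        Ss : S s ≡ true
        Ss = All.lookup (closed (proj₁ (kept⁻ S′u)) (I-S v∈) path′ (≤r⇒<2q (≤-trans len x≤r))) s∈

      a∉I : a ∉ I
      a∉I a∈ = All.lookup (AllPairs.head E-unique) (∈-++⁺ˡ a∈) refl

      b∉I : b ∉ I
      b∉I b∈ = Unique-++-disjoint I (AllPairs.tail E-unique) b∈ (here refl) refl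

      S′a : S′ a ≡ true
      S′a = kept⁺ (E-S here) a∉I

      S′b : S′ b ≡ true
      S′b = kept⁺ (E-S E-b) b∉I

      module ReachBound (IH : ∀ x → x ≤ r → ∀ {w} → S′ w ≡ true → Bounded R x w)
                        (y : ℕ) (X≤r : suc y ≤ r) {v : V} (v∈ : v ∈ I)
                        (L : List V) (uL : Unique L) (reach : All (WReach′ R (suc y) v) L) where

        X : ℕ
        X = suc y

        open Split S′ L uL reach

        i₀ : ℕ
        i₀ = proj₁ (internal⇒position v∈)
        i₀<k : i₀ < k
        i₀<k = proj₁ (proj₂ (internal⇒position v∈))
        i : ℕ
        i = suc i₀
        v↦ : E [ i ]= v
        v↦ = proj₂ (proj₂ (internal⇒position v∈))

        gone-count : ∀ lo hi t →
                     (∀ {u j} → u ∈ I → E [ suc j ]= u → WReach′ R X v u → (lo ≤ suc j × suc j ≤ hi) ⊎ (suc j ≡ q × t ≡ 1)) →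
                     length Gone ≤ (suc hi ∸ lo) + t
        gone-count lo hi t classify = length≤window E lo hi centre t Gone unique-gone (All.map locate all-gone)
          where
          locate : ∀ {u} → WReach′ R X v u × S′ u ≡ false →
                   (∃ λ j → lo ≤ j × j ≤ hi × E [ j ]= u) ⊎ (u ≡ centre × t ≡ 1)
          locate (ru , S′u) with removed (WReach′-initial initial (I-S v∈) ru) S′u
          ... | u∈ with internal⇒position u∈
          ...   | j , _ , u↦ with classify u∈ u↦ ru
          ...     | inj₁ (lo≤j , j≤hi) = inj₁ (suc j , lo≤j , j≤hi , u↦)
          ...     | inj₂ (j≡q , t≡1)   = inj₂ ([]=-functional (subst (λ j → E [ j ]= _) j≡q u↦) E-centre , t≡1)

        Exit : ℕ → V → Set
        Exit d s = ∀ {u} → WReach′ R X v u × S′ u ≡ true → WReach′ R (X ∸ d) s u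

        kept-via : ∀ d {s} → S′ s ≡ true → Exit d s → FBound q r (X ∸ d) (length Kept)
        kept-via d S′s exit′ = IH (X ∸ d) (≤-trans (m∸n≤m X d) X≤r) S′s Kept unique-kept (All.map exit′ all-kept)

        kept-none : (∀ {u} → WReach′ R X v u × S′ u ≡ true → ⊥) → length Kept ≡ 0
        kept-none none with Kept | all-kept
        ... | []    | _      = refl
        ... | _ ∷ _ | p ∷ _  = contradiction p none

        no-exit-a : ∀ {sl} → q ≤ i → sl ≤ X → ¬ i ≤ sl
        no-exit-a q≤i sl≤X i≤sl = <⇒≱ (≤-trans (s≤s X≤r) r<q) (≤-trans q≤i (≤-trans i≤sl sl≤X))

        no-exit-b : ∀ {sl} → i ≤ q → sl ≤ X → ¬ suc k ≤ i + sl
        no-exit-b i≤q sl≤X k≤ = <⇒≱ (≤-trans (+-monoʳ-< i (≤-trans (s≤s sl≤X) (≤-trans (s≤s X≤r) r<q)))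
                                              (≤-trans (+-monoˡ-≤ q i≤q) (≤-reflexive (cong (q +_) (sym (+-identityʳ q))))))
                                    (≤-trans long k≤)

        finish-shift : ∀ d t → 1 ≤ d → d ≤ X → t ≤ 1 → (t ≡ 1 → q ≤ d + X) → length Gone ≤ d + t →
                       FBound q r (X ∸ d) (length Kept) → FBound q r X (length L)
        finish-shift d t 1≤d d≤X t≤1 t⇒ gone≤ kept =
          FBound-downClosed X (≤-trans (≤-reflexive length-split)
                                (≤-trans (+-monoʳ-≤ (length Kept) gone≤) (≤-reflexive (+-comm (length Kept) (d + t)))))
            (subst (λ x → FBound q r x (d + t + length Kept)) (m+[n∸m]≡n d≤X)
              (FBound-shift 1≤d (subst (_≤ r) (sym (m+[n∸m]≡n d≤X)) X≤r) r<q t≤1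
                (λ t≡1 → subst (λ x → q ≤ d + x) (sym (m+[n∸m]≡n d≤X)) (t⇒ t≡1)) kept))

        finish-linear : length Kept ≡ 0 → length Gone ≤ X + 2 → FBound q r X (length L)
        finish-linear kept≡0 gone≤ =
          FBound-linear (s≤s z≤n) (subst (_≤ X + 2) (sym (trans length-split (cong (_+ length Gone) kept≡0))) gone≤)

        ≤X+2 : ∀ {t} → t ≤ 1 → suc X + t ≤ X + 2
        ≤X+2 t≤1 = ≤-trans (+-monoʳ-≤ (suc X) t≤1) (≤-reflexive (trans (+-comm (suc X) 1) (sym (+-comm X 2))))

        left-near : i < q → i ≤ X → FBound q r X (length L)
        left-near i<q i≤X =
          finish-shift i t (s≤s z≤n) i≤X (indicator≤1 dq) (indicator≡1 dq) (gone-count 1 i t classify) (kept-via i S′a via-a)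
          where
          dq : Dec (q ≤ i + X)
          dq = q ≤? i + X
          t : ℕ
          t = indicator dq
          classify : ∀ {u j} → u ∈ I → E [ suc j ]= u → WReach′ R X v u → (1 ≤ suc j × suc j ≤ i) ⊎ (suc j ≡ q × t ≡ 1)
          classify u∈ u↦ ru with reach-left X≤r v∈ v↦ i<q u∈ u↦ ru
          ... | inj₁ (j≤i , _)     = inj₁ (s≤s z≤n , j≤i)
          ... | inj₂ (j≡q , q≤i+X) = inj₂ (j≡q , indicator-yes dq q≤i+X)
          via-a : Exit i a
          via-a (ru , S′u) with exit X≤r v∈ v↦ S′u ru
          ... | _ , _ , rs , _    , inj₁ (refl , i≤sl) = WReach′-mono (∸-monoʳ-≤ X i≤sl) rs
          ... | _ , _ , _  , sl≤X , inj₂ (_ , k≤)      = contradiction k≤ (no-exit-b (<⇒≤ i<q) sl≤X)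

        left-far : i < q → X < i → FBound q r X (length L)
        left-far i<q X<i =
          finish-linear (kept-none none)
            (≤-trans (gone-count (i ∸ X) i t classify) (≤-trans (≤-reflexive window-size) (≤X+2 (indicator≤1 dq))))
          where
          dq : Dec (q ≤ i + X)
          dq = q ≤? i + X
          t : ℕ
          t = indicator dq
          classify : ∀ {u j} → u ∈ I → E [ suc j ]= u → WReach′ R X v u →
                     (i ∸ X ≤ suc j × suc j ≤ i) ⊎ (suc j ≡ q × t ≡ 1)
          classify {j = j} u∈ u↦ ru with reach-left X≤r v∈ v↦ i<q u∈ u↦ ru
          ... | inj₁ (j≤i , i≤j+X) = inj₁ (m≤n+o⇒m∸n≤o i X (≤-trans i≤j+X (≤-reflexive (+-comm (suc j) X))) , j≤i)
          ... | inj₂ (j≡q , q≤i+X) = inj₂ (j≡q , indicator-yes dq q≤i+X)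
          window-size : (suc i ∸ (i ∸ X)) + t ≡ suc X + t
          window-size = cong (_+ t) (trans (+-∸-assoc 1 (m∸n≤m i X)) (cong suc (m∸[m∸n]≡n (<⇒≤ X<i))))
          none : ∀ {u} → WReach′ R X v u × S′ u ≡ true → ⊥
          none (ru , S′u) with exit X≤r v∈ v↦ S′u ru
          ... | _ , _ , _ , sl≤X , inj₁ (_ , i≤sl) = <⇒≱ X<i (≤-trans i≤sl sl≤X)
          ... | _ , _ , _ , sl≤X , inj₂ (_ , k≤)   = no-exit-b (<⇒≤ i<q) sl≤X k≤

        at-centre : i ≡ q → FBound q r X (length L)
        at-centre i≡q = finish-linear (kept-none none) (≤-trans (gone-count q q 0 classify) one≤X+2)
          where
          classify : ∀ {u j} → u ∈ I → E [ suc j ]= u → WReach′ R X v u → (q ≤ suc j × suc j ≤ q) ⊎ (suc j ≡ q × 0 ≡ 1)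
          classify u∈ u↦ ru = let j≡q = reach-centre v∈ v↦ i≡q u∈ u↦ ru in inj₁ (≤-reflexive (sym j≡q) , ≤-reflexive j≡q)
          one≤X+2 : (suc q ∸ q) + 0 ≤ X + 2
          one≤X+2 = ≤-trans (≤-reflexive (trans (+-identityʳ _) (m+n∸n≡m 1 q))) (s≤s z≤n)
          none : ∀ {u} → WReach′ R X v u × S′ u ≡ true → ⊥
          none (ru , S′u) with exit X≤r v∈ v↦ S′u ru
          ... | _ , _ , _ , sl≤X , inj₁ (_ , i≤sl) = no-exit-a (≤-reflexive (sym i≡q)) sl≤X i≤sl
          ... | _ , _ , _ , sl≤X , inj₂ (_ , k≤)   = no-exit-b (≤-reflexive i≡q) sl≤X k≤

        right-near : q < i → suc k ∸ i ≤ X → FBound q r X (length L)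
        right-near q<i d≤X = finish-shift d t 1≤d d≤X (indicator≤1 dq) t⇒ (gone-count i k t classify) (kept-via d S′b via-b)
          where
          d : ℕ
          d = suc k ∸ i
          dq : Dec (i ≤ q + X)
          dq = i ≤? q + X
          t : ℕ
          t = indicator dq
          1≤d : 1 ≤ d
          1≤d = m<n⇒0<n∸m (s≤s i₀<k)
          t⇒ : t ≡ 1 → q ≤ d + X
          t⇒ t≡1 = +-cancelˡ-≤ q q (d + X) (begin
            q + q             ≡⟨ cong (q +_) (sym (+-identityʳ q)) ⟩
            2 * q             ≤⟨ long ⟩
            suc k             ≡⟨ sym (m∸n+n≡m (≤-trans (s≤s (<⇒≤ i₀<k)) ≤-refl)) ⟩
            d + i             ≤⟨ +-monoʳ-≤ d (indicator≡1 dq t≡1) ⟩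
            d + (q + X)       ≡⟨ sym (+-assoc d q X) ⟩
            d + q + X         ≡⟨ cong (_+ X) (+-comm d q) ⟩
            q + d + X         ≡⟨ +-assoc q d X ⟩
            q + (d + X)       ∎)
            where open ≤-Reasoning
          classify : ∀ {u j} → u ∈ I → E [ suc j ]= u → WReach′ R X v u → (i ≤ suc j × suc j ≤ k) ⊎ (suc j ≡ q × t ≡ 1)
          classify u∈ u↦ ru with reach-right X≤r v∈ v↦ q<i u∈ u↦ ru
          ... | inj₁ (i≤j , _ , j≤k) = inj₁ (i≤j , j≤k)
          ... | inj₂ (j≡q , i≤q+X)   = inj₂ (j≡q , indicator-yes dq i≤q+X)
          via-b : Exit d b
          via-b (ru , S′u) with exit X≤r v∈ v↦ S′u ru
          ... | _ , _ , _  , sl≤X , inj₁ (_ , i≤sl)   = contradiction i≤sl (no-exit-a (<⇒≤ q<i) sl≤X)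
          ... | _ , _ , rs , _    , inj₂ (refl , k≤) = WReach′-mono (∸-monoʳ-≤ X (m≤n+o⇒m∸n≤o (suc k) i k≤)) rs

        right-far : q < i → X < suc k ∸ i → FBound q r X (length L)
        right-far q<i X<d =
          finish-linear (kept-none none)
            (≤-trans (gone-count i (i + X) t classify) (≤-trans (≤-reflexive window-size) (≤X+2 (indicator≤1 dq))))
          where
          dq : Dec (i ≤ q + X)
          dq = i ≤? q + X
          t : ℕ
          t = indicator dq
          classify : ∀ {u j} → u ∈ I → E [ suc j ]= u → WReach′ R X v u → (i ≤ suc j × suc j ≤ i + X) ⊎ (suc j ≡ q × t ≡ 1)
          classify u∈ u↦ ru with reach-right X≤r v∈ v↦ q<i u∈ u↦ ru
          ... | inj₁ (i≤j , j≤i+X , _) = inj₁ (i≤j , j≤i+X)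
          ... | inj₂ (j≡q , i≤q+X)     = inj₂ (j≡q , indicator-yes dq i≤q+X)
          window-size : (suc (i + X) ∸ i) + t ≡ suc X + t
          window-size = cong (_+ t) (trans (cong (_∸ i) (sym (+-suc i X))) (m+n∸m≡n i (suc X)))
          none : ∀ {u} → WReach′ R X v u × S′ u ≡ true → ⊥
          none (ru , S′u) with exit X≤r v∈ v↦ S′u ru
          ... | _ , _ , _ , sl≤X , inj₁ (_ , i≤sl) = no-exit-a (<⇒≤ q<i) sl≤X i≤sl
          ... | _ , _ , _ , sl≤X , inj₂ (_ , k≤)   = <⇒≱ X<d (≤-trans (m≤n+o⇒m∸n≤o (suc k) i k≤) sl≤X)

        bound : FBound q r X (length L)
        bound with <-cmp i q
        ... | tri≈ _ i≡q _ = at-centre i≡q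
        ... | tri< i<q _ _ with i ≤? X
        ...   | yes i≤X = left-near i<q i≤X
        ...   | no  i≰X = left-far i<q (≰⇒> i≰X)
        bound | tri> _ _ q<i with suc k ∸ i ≤? X
        ...   | yes d≤X = right-near q<i d≤X
        ...   | no  d≰X = right-far q<i (≰⇒> d≰X)

      ear-bounded : (∀ x → x ≤ r → ∀ {w} → S′ w ≡ true → Bounded R x w) →
                    ∀ x → x ≤ r → ∀ {v} → v ∈ I → Bounded R x v
      ear-bounded IH zero    _   _  = bounded-zero
      ear-bounded IH (suc y) X≤r v∈ L uL reach = ReachBound.bound IH y X≤r v∈ L uL reach

    deleteEar : EliminationOrder S′ → EliminationOrder S
    deleteEar E′ = extend new E′ (proj₁ ∘ kept⁻) (λ w∈ → I-S (∈-resp-↭ new↭I w∈) , I-S′ (∈-resp-↭ new↭I w∈))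
                     (λ Sw S′w → ∈-resp-↭ (↭-sym new↭I) (removed Sw S′w)) unique-new closed′
                     λ R inc initial initial′ closed IH x x≤r v∈ →
                       Ranked.ear-bounded R inc initial initial′ closed IH x x≤r (∈-resp-↭ new↭I v∈)

  eliminationOrder : ∀ {S} → Reduces G (2 * q) S → EliminationOrder S
  eliminationOrder {S} (done empty) = record
    { order    = []
    ; unique   = []
    ; sound    = λ ()
    ; complete = ⊥-elim ∘ no-vertex
    ; bounded  = λ _ _ _ _ _ _ → ⊥-elim ∘ no-vertex
    }
    where
    no-vertex : ∀ {v} → S v ≡ true → ⊥
    no-vertex {v} Sv with trans (sym Sv) (empty v)
    ... | ()
  eliminationOrder (step _ (delVertex _ Sv deg≤1 S′≗) rest) = deleteVertex Sv (≤1 deg≤1) S′≗ (eliminationOrder rest)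
    where
    ≤1 : ∀ {d} → d ≡ 0 ⊎ d ≡ 1 → d ≤ 1
    ≤1 (inj₁ refl) = z≤n
    ≤1 (inj₂ refl) = s≤s z≤n
  eliminationOrder (step _ (delEar _ _ _ path inS deg2 long S′≗) rest) = Ear.deleteEar path inS deg2 long S′≗ (eliminationOrder rest)


listPermutation : ∀ {n} (o : List (Fin n)) → Unique o → (∀ v → v ∈ o) →
                  Σ (Permutation′ n) λ π → ∀ {i v} → o [ i ]= v → toℕ (π ⟨$⟩ʳ v) ≡ i
listPermutation {n} o uo complete = permutation to from to∘from from∘to , rank-to
  where
  length-allFin : length (allFin n) ≡ n
  length-allFin = length-tabulate (λ i → i)
  length-o : length o ≡ n
  length-o = ≤-antisym
    (subst (length o ≤_) length-allFin (length≤length (allFin n) o uo (All.universal ∈-allFin o)))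
    (subst (_≤ length o) length-allFin (length≤length o (allFin n) (Uniqueₚ.allFin⁺ n) (All.universal complete (allFin n))))
  position : ∀ v → Σ ℕ λ i → o [ i ]= v
  position v = ∈⇒[]= (complete v)
  position< : ∀ v → proj₁ (position v) < n
  position< v = subst (proj₁ (position v) <_) length-o ([]=⇒<length (proj₂ (position v)))
  to : Fin n → Fin n
  to v = fromℕ< (position< v)
  element : (i : Fin n) → Σ (Fin n) λ v → o [ toℕ i ]= v
  element i = <length⇒[]= o (subst (toℕ i <_) (sym length-o) (toℕ<n i))
  from : Fin n → Fin n
  from i = proj₁ (element i)
  rank-to : ∀ {i v} → o [ i ]= v → toℕ (to v) ≡ i
  rank-to {v = v} v↦ = trans (toℕ-fromℕ< (position< v)) ([]=-injective uo (proj₂ (position v)) v↦)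
  to∘from : ∀ i → to (from i) ≡ i
  to∘from i = toℕ-injective (rank-to (proj₂ (element i)))
  from∘to : ∀ v → from (to v) ≡ v
  from∘to v = []=-functional (proj₂ (element (to v))) (subst (λ i → o [ i ]= v) (sym (toℕ-fromℕ< (position< v))) (proj₂ (position v)))

mainTheorem17 : (r q : ℕ) → 1 ≤ r → r + 1 ≤ q →
    {n : ℕ} (G : Graph n) → PathDegenerate G (2 * q) →
    Σ (Permutation′ n) λ π → GoodOrder G π (FBound q r) r
mainTheorem17 r q _ r+1≤q {n} G degenerate = π , good
  where
  r<q : r < q
  r<q = subst (_≤ q) (+-comm r 1) r+1≤q
  open Invariant G q r r<q
  open EliminationOrder (eliminationOrder degenerate)
  ranking : Σ (Permutation′ n) λ π → ∀ {i v} → order [ i ]= v → toℕ (π ⟨$⟩ʳ v) ≡ i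
  ranking = listPermutation order unique (λ _ → complete refl)
  π : Permutation′ n
  π = proj₁ ranking
  increasing : Increasing (rank G π) order
  increasing a↦ b↦ i<j = subst₂ _<_ (sym (proj₂ ranking a↦)) (sym (proj₂ ranking b↦)) i<j
  good : GoodOrder G π (FBound q r) r
  good x x≤r v = bounded (rank G π) increasing (λ _ ()) (λ _ _ _ _ → All.universal (λ _ → refl) _) x x≤r refl
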